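{- Let $n$ be odd. Then $|RELS(n)|\neq|ROLS(n)|$ if and only if $$\sum_{0\le k,m<n/2}(-1)^{k+m}(n-2k)(n-2m)N_n(k,m)\neq 0,$$ where $N_n(k,m)$ is the number of reduced Latin squares of order $n$ of parity type $(k,m)$.
   Context: A Latin square of order $n$ is an $n\times n$ array with entries in $[n]$ in which each symbol appears exactly once in each row and column; rows and columns are viewed as permutations in $S_n$ (symbol $i$ in the $j$th place of a row/column $\pi$ means $\pi(i)=j$). It is reduced if its first row and first column are the identity permutation. Its parity is the product of the signs of all its rows and columns; it is even if the parity is $1$ and odd if it is $-1$. $RELS(n)$ and $ROLS(n)$ denote the sets of even and odd reduced Latin squares of order $n$. The parity type of a Latin square is $(k,m)$, with $0\le k,m\le n/2$, if $k$ rows have one sign and the other $n-k$ rows the opposite sign, and $m$ columns have one sign and the other $n-m$ columns the opposite sign. -}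

module Defs where

open import Data.Nat as ℕ using (ℕ; zero; suc; _*_; _%_; _≡ᵇ_; _<ᵇ_)
open import Data.Bool using (Bool; true; false; _∧_; _∨_; not; if_then_else_)
open import Data.Fin using (Fin; toℕ)
open import Data.List using (List; []; _∷_; map; concatMap; allFin; upTo)
open import Data.Integer as ℤ using (ℤ; +_; 0ℤ; 1ℤ; -1ℤ)
open import Relation.Binary.PropositionalEquality using (_≡_)

allFuns : {A : Set} → List A → (k : ℕ) → List (Fin k → A)
allFuns xs zero    = (λ ()) ∷ []
allFuns xs (suc k) = concatMap (λ a → map (λ f → cons a f) (allFuns xs k)) xs
  where
  cons : _ → (Fin k → _) → Fin (suc k) → _
  cons a f Fin.zero    = a
  cons a f (Fin.suc i) = f i

count : {A : Set} → (A → Bool) → List A → ℕ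
count p []       = 0
count p (x ∷ xs) = if p x then suc (count p xs) else count p xs

allF : (n : ℕ) → (Fin n → Bool) → Bool
allF n p = Data.List.foldr (λ i b → p i ∧ b) true (allFin n)

_==_ : {n : ℕ} → Fin n → Fin n → Bool
i == j = toℕ i ≡ᵇ toℕ j

_<F_ : {n : ℕ} → Fin n → Fin n → Bool
i <F j = toℕ i <ᵇ toℕ j

isOdd : ℕ → Bool
isOdd k = (k % 2) ≡ᵇ 1

-- A candidate array of order n: L r c is the symbol in row r, column c.
Array : ℕ → Set
Array n = Fin n → Fin n → Fin n

allArrays : (n : ℕ) → List (Array n)
allArrays n = allFuns (allFuns (allFin n) n) n

isLatin : {n : ℕ} → Array n → Bool
isLatin {n} L =
  allF n (λ r → allF n (λ s → count (λ c → L r c == s) (allFin n) ≡ᵇ 1))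
  ∧ allF n (λ c → allF n (λ s → count (λ r → L r c == s) (allFin n) ≡ᵇ 1))

isReduced : {n : ℕ} → Array n → Bool
isReduced {n} L =
  allF n (λ r → allF n (λ c →
    (not (toℕ r ≡ᵇ 0) ∨ (L r c == c)) ∧ (not (toℕ c ≡ᵇ 0) ∨ (L r c == r))))

-- A line (row or column) as a sequence: position p ↦ symbol at p.
-- The permutation π of the line is given by π(symbol) = position.
-- Inversions of π are pairs of symbols i < j with π i > π j; these are in
-- bijection (i,j) ↦ (π j, π i) with pairs of positions p < q with
-- seq p > seq q.  So the number of inversions of π is:
lineInversions : {n : ℕ} → (Fin n → Fin n) → ℕ
lineInversions {n} seq =
  count (λ pq → (Data.Product.proj₁ pq <F Data.Product.proj₂ pq)
                ∧ (seq (Data.Product.proj₂ pq) <F seq (Data.Product.proj₁ pq)))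
        (concatMap (λ p → map (λ q → p Data.Product., q) (allFin n)) (allFin n))
  where import Data.Product

lineOdd : {n : ℕ} → (Fin n → Fin n) → Bool
lineOdd seq = isOdd (lineInversions seq)

oddRows : {n : ℕ} → Array n → ℕ
oddRows {n} L = count (λ r → lineOdd (λ c → L r c)) (allFin n)

oddCols : {n : ℕ} → Array n → ℕ
oddCols {n} L = count (λ c → lineOdd (λ r → L r c)) (allFin n)

-- parity (product of signs of all rows and columns) is −1
isOddSquare : {n : ℕ} → Array n → Bool
isOddSquare L = isOdd (oddRows L ℕ.+ oddCols L)

isReducedLatin : {n : ℕ} → Array n → Bool
isReducedLatin L = isLatin L ∧ isReduced L

RELS-card : ℕ → ℕ
RELS-card n = count (λ L → isReducedLatin L ∧ not (isOddSquare L)) (allArrays n)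

ROLS-card : ℕ → ℕ
ROLS-card n = count (λ L → isReducedLatin L ∧ isOddSquare L) (allArrays n)

-- k of the n lines have one sign and n−k the opposite sign, 0 ≤ k ≤ n/2
-- (here o is the number of odd lines)
typeMatches : ℕ → ℕ → ℕ → Bool
typeMatches n o k = (not (n <ᵇ 2 * k)) ∧ ((o ≡ᵇ k) ∨ ((o ℕ.+ k) ≡ᵇ n))

hasParityType : {n : ℕ} → Array n → ℕ → ℕ → Bool
hasParityType {n} L k m = typeMatches n (oddRows L) k ∧ typeMatches n (oddCols L) m

N : ℕ → ℕ → ℕ → ℕ
N n k m = count (λ L → isReducedLatin L ∧ hasParityType L k m) (allArrays n)

signPow : ℕ → ℤ
signPow e = if isOdd e then -1ℤ else 1ℤ

term : ℕ → ℕ → ℕ → ℤ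
term n k m = signPow (k ℕ.+ m) ℤ.* ((+ n) ℤ.- (+ (2 * k)))
             ℤ.* ((+ n) ℤ.- (+ (2 * m))) ℤ.* (+ N n k m)

sumZ : List ℤ → ℤ
sumZ = Data.List.foldr ℤ._+_ 0ℤ

halfRange : ℕ → List ℕ
halfRange n = Data.List.filterᵇ (λ k → 2 * k <ᵇ n) (upTo n)

paritySum : ℕ → ℤ
paritySum n = sumZ (concatMap (λ k → map (λ m → term n k m) (halfRange n)) (halfRange n))

Odd : ℕ → Set
Odd n = n % 2 ≡ 1

module Submission where

-- It follows from the identity  paritySum n = n² (|RELS(n)| − |ROLS(n)|)  (MainIdentity).
-- Write w(o) = (−1)^o (n − 2o) and sgn for the sign of a square or a line.
--  1. If o of the n rows are odd, the row signs add up to n − 2o; hence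
--     sgn(L) · Σ_r sgn(row r) · Σ_c sgn(col c) = w(#odd rows) · w(#odd columns).
--  2. For odd n, w(n − o) = w(o), so summing over parity types collapses:
--     paritySum n = Σ_{L reduced Latin} w(#odd rows) · w(#odd columns).
--  3. Relabelling a reduced Latin square L along row r and column c (Isotopy) gives a
--     reduced Latin square of sign sgn(L) sgn(row r) sgn(col c), and is an involution
--     on cells (L , r , c); reindexing by it, the sum in 1–2 equals n² Σ_L sgn(L).

open import Defs
open import Data.Nat using (ℕ)
open import Data.Integer using (0ℤ)
open import Relation.Binary.PropositionalEquality using (_≢_)
open import Function.Bundles using (_⇔_; mk⇔; Equivalence)

open import Algebra.Bundles using (CommutativeSemiring; CommutativeMonoid; CommutativeRing)
import Algebra.Properties.CommutativeSemigroup
open import Data.Nat as ℕ using (zero; suc; _≡ᵇ_; _<ᵇ_)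
import Data.Nat.Properties as ℕP
import Data.Bool
open import Data.Bool using (Bool; true; false; _∧_; _∨_; not; if_then_else_; _xor_)
import Data.Bool.Properties as BoolP
open import Data.Fin as F using (Fin; toℕ)
import Data.Fin.Properties as FinP
open import Data.Fin.Permutation using (Permutation′; _⟨$⟩ʳ_; _⟨$⟩ˡ_; inverseˡ; inverseʳ; permutation; flip; _∘ₚ_)
import Data.Fin.Permutation.Components as PC
open import Data.List using (List; []; _∷_; map; concatMap; allFin; upTo; _++_; tabulate; length)
import Data.List.Properties as ListP
open import Data.Product using (_×_; _,_; proj₁; proj₂)
open import Data.Integer as ℤ using (ℤ; +_; 1ℤ; -1ℤ)
import Data.Integer.Properties as ℤP
open import Data.Integer.Tactic.RingSolver using (solve-∀)
open import Data.Empty using (⊥; ⊥-elim)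
import Data.Sum
open import Data.Sum using (_⊎_; inj₁; inj₂)
open import Relation.Nullary using (¬_; yes; no)
open import Relation.Nullary.Decidable using (dec-true; dec-false)
import Relation.Binary.PropositionalEquality as ≡
open ≡ using (_≡_; refl; cong; cong₂; subst)

bool-ext : ∀ {a b : Bool} → (a ≡ true → b ≡ true) → (b ≡ true → a ≡ true) → a ≡ b
bool-ext {false} {false} _ _ = refl
bool-ext {false} {true}  _ g = g refl
bool-ext {true}  {false} f _ = ≡.sym (f refl)
bool-ext {true}  {true}  _ _ = refl

∧-proj₁ : ∀ {a b} → a ∧ b ≡ true → a ≡ true
∧-proj₁ {true} _ = refl

∧-proj₂ : ∀ {a b} → a ∧ b ≡ true → b ≡ true
∧-proj₂ {true} p = p

∧-intro : ∀ {a b} → a ≡ true → b ≡ true → a ∧ b ≡ true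
∧-intro refl refl = refl

-- A Boolean-valued equivalence relation.  Arrays are functions, which can only be
-- compared pointwise, so sums over arrays are reindexed up to such an equivalence.
record BoolEq (A : Set) : Set where
  field
    eq       : A → A → Bool
    eq-refl  : ∀ a → eq a a ≡ true
    eq-sym   : ∀ a b → eq a b ≡ true → eq b a ≡ true
    eq-trans : ∀ a b c → eq a b ≡ true → eq b c ≡ true → eq a c ≡ true

Respects : ∀ {b} {A : Set} {B : Set b} → BoolEq A → (A → B) → Set b
Respects E f = ∀ a b → BoolEq.eq E a b ≡ true → f a ≡ f b

PreservesEq : {A : Set} → BoolEq A → (A → A) → Set
PreservesEq E f = ∀ a b → BoolEq.eq E a b ≡ true → BoolEq.eq E (f a) (f b) ≡ true

Enumerates : {A : Set} → BoolEq A → List A → Set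
Enumerates E xs = ∀ a → count (λ x → BoolEq.eq E x a) xs ≡ 1

pairs : {A B : Set} → List A → List B → List (A × B)
pairs xs ys = concatMap (λ a → map (λ b → a , b) ys) xs

module FiniteSums {c ℓ} (R : CommutativeSemiring c ℓ) where
  open CommutativeSemiring R renaming (refl to ≈-refl; sym to ≈-sym; trans to ≈-trans)
  open import Relation.Binary.Reasoning.Setoid setoid
  open import Algebra.Properties.CommutativeSemigroup
    (CommutativeMonoid.commutativeSemigroup +-commutativeMonoid) using (interchange)

  ∑ : {A : Set} → (A → Carrier) → List A → Carrier
  ∑ f []       = 0#
  ∑ f (x ∷ xs) = f x + ∑ f xs

  guard : Bool → Carrier → Carrier
  guard true  v = v
  guard false v = 0#

  fromℕ : ℕ → Carrier
  fromℕ zero    = 0#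
  fromℕ (suc n) = 1# + fromℕ n

  ∑-cong : {A : Set} {f g : A → Carrier} (xs : List A) →
           (∀ x → f x ≈ g x) → ∑ f xs ≈ ∑ g xs
  ∑-cong []       f≈g = ≈-refl
  ∑-cong (x ∷ xs) f≈g = +-cong (f≈g x) (∑-cong xs f≈g)

  ∑-zero : {A : Set} (xs : List A) → ∑ (λ _ → 0#) xs ≈ 0#
  ∑-zero []       = ≈-refl
  ∑-zero (x ∷ xs) = ≈-trans (+-identityˡ _) (∑-zero xs)

  ∑-+ : {A : Set} (f g : A → Carrier) (xs : List A) →
        ∑ (λ x → f x + g x) xs ≈ ∑ f xs + ∑ g xs
  ∑-+ f g []       = ≈-sym (+-identityˡ 0#)
  ∑-+ f g (x ∷ xs) = ≈-trans (+-congˡ (∑-+ f g xs)) (interchange (f x) (g x) (∑ f xs) (∑ g xs))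

  ∑-*ˡ : {A : Set} (a : Carrier) (f : A → Carrier) (xs : List A) →
         a * ∑ f xs ≈ ∑ (λ x → a * f x) xs
  ∑-*ˡ a f []       = zeroʳ a
  ∑-*ˡ a f (x ∷ xs) = ≈-trans (distribˡ a (f x) (∑ f xs)) (+-congˡ (∑-*ˡ a f xs))

  ∑-*ʳ : {A : Set} (a : Carrier) (f : A → Carrier) (xs : List A) →
         ∑ f xs * a ≈ ∑ (λ x → f x * a) xs
  ∑-*ʳ a f xs = ≈-trans (*-comm _ a) (≈-trans (∑-*ˡ a f xs) (∑-cong xs (λ x → *-comm a (f x))))

  ∑-swap : {A B : Set} (f : A → B → Carrier) (xs : List A) (ys : List B) →
           ∑ (λ x → ∑ (f x) ys) xs ≈ ∑ (λ y → ∑ (λ x → f x y) xs) ys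
  ∑-swap f []       ys = ≈-sym (∑-zero ys)
  ∑-swap f (x ∷ xs) ys =
    ≈-trans (+-congˡ (∑-swap f xs ys)) (≈-sym (∑-+ (f x) (λ y → ∑ (λ x → f x y) xs) ys))

  ∑-++ : {A : Set} (f : A → Carrier) (xs ys : List A) → ∑ f (xs ++ ys) ≈ ∑ f xs + ∑ f ys
  ∑-++ f []       ys = ≈-sym (+-identityˡ _)
  ∑-++ f (x ∷ xs) ys = ≈-trans (+-congˡ (∑-++ f xs ys)) (≈-sym (+-assoc _ _ _))

  ∑-concatMap : {A B : Set} (f : B → Carrier) (F : A → List B) (xs : List A) →
                ∑ f (concatMap F xs) ≈ ∑ (λ x → ∑ f (F x)) xs
  ∑-concatMap f F []       = ≈-refl
  ∑-concatMap f F (x ∷ xs) =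
    ≈-trans (∑-++ f (F x) (concatMap F xs)) (+-congˡ (∑-concatMap f F xs))

  ∑-map : {A B : Set} (f : B → Carrier) (h : A → B) (xs : List A) →
          ∑ f (map h xs) ≈ ∑ (λ x → f (h x)) xs
  ∑-map f h []       = ≈-refl
  ∑-map f h (x ∷ xs) = +-congˡ (∑-map f h xs)

  ∑-tabulate : {A : Set} (n : ℕ) (f : A → Carrier) (g : Fin n → A) →
               ∑ f (tabulate g) ≈ ∑ (λ i → f (g i)) (allFin n)
  ∑-tabulate zero    f g = ≈-refl
  ∑-tabulate (suc n) f g = +-congˡ (≈-trans (∑-tabulate n f (λ i → g (F.suc i)))
                                          (≈-sym (∑-tabulate n (λ i → f (g i)) F.suc)))

  ∑-allFin-suc : (n : ℕ) (f : Fin (suc n) → Carrier) →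
                 ∑ f (allFin (suc n)) ≈ f F.zero + ∑ (λ i → f (F.suc i)) (allFin n)
  ∑-allFin-suc n f = +-congˡ (∑-tabulate n f F.suc)

  ∑-const : (n : ℕ) (v : Carrier) → ∑ (λ _ → v) (allFin n) ≈ fromℕ n * v
  ∑-const zero    v = ≈-sym (zeroˡ v)
  ∑-const (suc n) v = begin
    ∑ (λ _ → v) (allFin (suc n))  ≈⟨ ∑-allFin-suc n (λ _ → v) ⟩
    v + ∑ (λ _ → v) (allFin n)    ≈⟨ +-cong (≈-sym (*-identityˡ v)) (∑-const n v) ⟩
    1# * v + fromℕ n * v          ≈⟨ distribʳ v 1# (fromℕ n) ⟨
    (1# + fromℕ n) * v            ∎

  guard-* : ∀ b v → guard b v ≈ guard b 1# * v
  guard-* true  v = ≈-sym (*-identityˡ v)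
  guard-* false v = ≈-sym (zeroˡ v)

  guard-∧ : ∀ a b v → guard (a ∧ b) v ≈ guard a (guard b v)
  guard-∧ true  b v = ≈-refl
  guard-∧ false b v = ≈-refl

  guard-comm : ∀ a b v → guard a (guard b v) ≈ guard b (guard a v)
  guard-comm true  b     v = ≈-refl
  guard-comm false true  v = ≈-refl
  guard-comm false false v = ≈-refl

  guard-cong : ∀ b {u v} → (b ≡ true → u ≈ v) → guard b u ≈ guard b v
  guard-cong true  u≈v = u≈v ≡.refl
  guard-cong false u≈v = ≈-refl

  guard-∑ : {A : Set} (b : Bool) (f : A → Carrier) (xs : List A) →
            guard b (∑ f xs) ≈ ∑ (λ x → guard b (f x)) xs
  guard-∑ true  f xs = ≈-refl
  guard-∑ false f xs = ≈-sym (∑-zero xs)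

  ∑-count : {A : Set} (p : A → Bool) (xs : List A) →
            ∑ (λ x → guard (p x) 1#) xs ≈ fromℕ (count p xs)
  ∑-count p []       = ≈-refl
  ∑-count p (x ∷ xs) with p x
  ... | true  = +-congˡ (∑-count p xs)
  ... | false = ≈-trans (+-identityˡ _) (∑-count p xs)

  ∑-guard : {A : Set} (p : A → Bool) (v : Carrier) (xs : List A) →
            ∑ (λ x → guard (p x) v) xs ≈ fromℕ (count p xs) * v
  ∑-guard p v xs = begin
    ∑ (λ x → guard (p x) v) xs       ≈⟨ ∑-cong xs (λ x → guard-* (p x) v) ⟩
    ∑ (λ x → guard (p x) 1# * v) xs  ≈⟨ ∑-*ʳ v _ xs ⟨
    ∑ (λ x → guard (p x) 1#) xs * v  ≈⟨ *-congʳ (∑-count p xs) ⟩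
    fromℕ (count p xs) * v           ∎

  ∑-guard-unique : {A : Set} (p : A → Bool) (v : Carrier) (xs : List A) →
                   count p xs ≡ 1 → ∑ (λ x → guard (p x) v) xs ≈ v
  ∑-guard-unique p v xs one = begin
    ∑ (λ x → guard (p x) v) xs  ≈⟨ ∑-guard p v xs ⟩
    fromℕ (count p xs) * v      ≡⟨ ≡.cong (λ k → fromℕ k * v) one ⟩
    (1# + 0#) * v               ≈⟨ *-congʳ (+-identityʳ 1#) ⟩
    1# * v                      ≈⟨ *-identityˡ v ⟩
    v                           ∎

  ∑-pairs : {A B : Set} (f : A × B → Carrier) (xs : List A) (ys : List B) →
            ∑ f (pairs xs ys) ≈ ∑ (λ a → ∑ (λ b → f (a , b)) ys) xs
  ∑-pairs f xs ys = ≈-trans (∑-concatMap f _ xs) (∑-cong xs (λ a → ∑-map f _ ys))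

  ∑-product : {A B : Set} (f : A → Carrier) (g : B → Carrier) (xs : List A) (ys : List B) →
              ∑ (λ x → ∑ (λ y → f x * g y) ys) xs ≈ ∑ f xs * ∑ g ys
  ∑-product f g xs ys = ≈-sym (begin
    ∑ f xs * ∑ g ys                   ≈⟨ ∑-*ʳ (∑ g ys) f xs ⟩
    ∑ (λ x → f x * ∑ g ys) xs         ≈⟨ ∑-cong xs (λ x → ∑-*ˡ (f x) g ys) ⟩
    ∑ (λ x → ∑ (λ y → f x * g y) ys) xs ∎)

  module Enumerated {A : Set} (E : BoolEq A) (xs : List A) (enum : Enumerates E xs) where
    open BoolEq E

    pick : (h : A → Carrier) → Respects E h → ∀ a → ∑ (λ y → guard (eq y a) (h y)) xs ≈ h a
    pick h resp a = ≈-trans (∑-cong xs (λ y → guard-cong (eq y a) (λ e → reflexive (resp y a e))))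
                            (∑-guard-unique (λ y → eq y a) (h a) xs (enum a))

    reindex : (Ψ Φ : A → A) → PreservesEq E Ψ → PreservesEq E Φ →
      (P : A → Bool) → Respects E P → (f : A → Carrier) → Respects E f →
      (∀ a → P a ≡ true → P (Ψ a) ≡ true) → (∀ a → P a ≡ true → P (Φ a) ≡ true) →
      (∀ a → P a ≡ true → eq (Φ (Ψ a)) a ≡ true) → (∀ a → P a ≡ true → eq (Ψ (Φ a)) a ≡ true) →
      ∑ (λ x → guard (P x) (f (Ψ x))) xs ≈ ∑ (λ x → guard (P x) (f x)) xs
    reindex Ψ Φ Ψ-eq Φ-eq P P-resp f f-resp PΨ PΦ ΦΨ ΨΦ = begin
      ∑ (λ x → guard (P x) (f (Ψ x))) xs
        ≈⟨ ∑-cong xs (λ x → guard-cong (P x) (λ _ → pick f f-resp (Ψ x))) ⟨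
      ∑ (λ x → guard (P x) (∑ (λ y → guard (eq y (Ψ x)) (f y)) xs)) xs
        ≈⟨ ∑-cong xs (λ x → ≈-trans (guard-∑ (P x) _ xs)
                                    (∑-cong xs (λ y → ≈-sym (guard-∧ (P x) (eq y (Ψ x)) (f y))))) ⟩
      ∑ (λ x → ∑ (λ y → guard (P x ∧ eq y (Ψ x)) (f y)) xs) xs
        ≈⟨ ∑-swap (λ x y → guard (P x ∧ eq y (Ψ x)) (f y)) xs xs ⟩
      ∑ (λ y → ∑ (λ x → guard (P x ∧ eq y (Ψ x)) (f y)) xs) xs
        ≈⟨ ∑-cong xs (λ y → ∑-cong xs (λ x → reflexive (cong (λ b → guard b (f y)) (graph-sym x y)))) ⟩
      ∑ (λ y → ∑ (λ x → guard (P y ∧ eq x (Φ y)) (f y)) xs) xs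
        ≈⟨ ∑-cong xs (λ y → ∑-cong xs (λ x → ≈-trans (guard-∧ (P y) (eq x (Φ y)) (f y))
                                                      (guard-comm (P y) (eq x (Φ y)) (f y)))) ⟩
      ∑ (λ y → ∑ (λ x → guard (eq x (Φ y)) (guard (P y) (f y))) xs) xs
        ≈⟨ ∑-cong xs (λ y → ∑-guard-unique (λ x → eq x (Φ y)) (guard (P y) (f y)) xs (enum (Φ y))) ⟩
      ∑ (λ y → guard (P y) (f y)) xs ∎
      where
      graph-sym : ∀ x y → (P x ∧ eq y (Ψ x)) ≡ (P y ∧ eq x (Φ y))
      graph-sym x y = bool-ext forth back
        where
        forth : P x ∧ eq y (Ψ x) ≡ true → P y ∧ eq x (Φ y) ≡ true
        forth h = ∧-intro Py (eq-sym _ _ (eq-trans _ _ _ (Φ-eq y (Ψ x) y≈Ψx) (ΦΨ x Px)))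
          where
          Px = ∧-proj₁ h
          y≈Ψx = ∧-proj₂ {P x} h
          Py = ≡.trans (≡.sym (P-resp (Ψ x) y (eq-sym _ _ y≈Ψx))) (PΨ x Px)
        back : P y ∧ eq x (Φ y) ≡ true → P x ∧ eq y (Ψ x) ≡ true
        back h = ∧-intro Px (eq-sym _ _ (eq-trans _ _ _ (Ψ-eq x (Φ y) x≈Φy) (ΨΦ y Py)))
          where
          Py = ∧-proj₁ h
          x≈Φy = ∧-proj₂ {P y} h
          Px = ≡.trans (P-resp x (Φ y) x≈Φy) (PΦ y Py)

module ℕ∑ = FiniteSums ℕP.+-*-commutativeSemiring
module ℤ∑ = FiniteSums ℤP.+-*-commutativeSemiring
module 𝔽₂∑ = FiniteSums (CommutativeRing.commutativeSemiring BoolP.xor-∧-commutativeRing)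

open ℕ∑ using () renaming (∑ to ∑ℕ)
open ℤ∑ using (guard) renaming (∑ to ∑ℤ)
open 𝔽₂∑ using () renaming (∑ to ⨁)

count-cong : ∀ {A : Set} {p q : A → Bool} (xs : List A) → (∀ x → p x ≡ q x) →
             count p xs ≡ count q xs
count-cong []       p≡q = refl
count-cong (x ∷ xs) p≡q rewrite p≡q x | count-cong xs p≡q = refl

count≡∑ : ∀ {A : Set} (p : A → Bool) (xs : List A) → count p xs ≡ ∑ℕ (λ x → ℕ∑.guard (p x) 1) xs
count≡∑ p xs = ≡.sym (≡.trans (ℕ∑.∑-count p xs) (fromℕ-id (count p xs)))
  where
  fromℕ-id : ∀ n → ℕ∑.fromℕ n ≡ n
  fromℕ-id zero    = refl
  fromℕ-id (suc n) = cong suc (fromℕ-id n)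

isOdd-suc : ∀ n → isOdd (suc n) ≡ not (isOdd n)
isOdd-suc zero    = refl
isOdd-suc (suc n) = ≡.trans (≡.sym (BoolP.not-involutive (isOdd n))) (cong not (≡.sym (isOdd-suc n)))

isOdd-+ : ∀ a b → isOdd (a ℕ.+ b) ≡ isOdd a xor isOdd b
isOdd-+ zero    b = refl
isOdd-+ (suc a) b = begin
  isOdd (suc (a ℕ.+ b))          ≡⟨ isOdd-suc (a ℕ.+ b) ⟩
  not (isOdd (a ℕ.+ b))          ≡⟨ cong not (isOdd-+ a b) ⟩
  not (isOdd a xor isOdd b)      ≡⟨ BoolP.not-distribˡ-xor (isOdd a) (isOdd b) ⟩
  not (isOdd a) xor isOdd b      ≡⟨ cong (_xor isOdd b) (isOdd-suc a) ⟨
  isOdd (suc a) xor isOdd b      ∎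
  where open ≡.≡-Reasoning

isOdd-count : ∀ {A : Set} (p : A → Bool) (xs : List A) → isOdd (count p xs) ≡ ⨁ p xs
isOdd-count p []       = refl
isOdd-count p (x ∷ xs) with p x
... | true  = ≡.trans (isOdd-suc (count p xs)) (cong not (isOdd-count p xs))
... | false = isOdd-count p xs

==-refl : ∀ {n} (i : Fin n) → (i == i) ≡ true
==-refl F.zero    = refl
==-refl (F.suc i) = ==-refl i

==⇒≡ : ∀ {n} (i j : Fin n) → (i == j) ≡ true → i ≡ j
==⇒≡ F.zero    F.zero    _ = refl
==⇒≡ (F.suc i) (F.suc j) h = cong F.suc (==⇒≡ i j h)

≡⇒== : ∀ {n} {i j : Fin n} → i ≡ j → (i == j) ≡ true
≡⇒== {i = i} refl = ==-refl i

≢⇒== : ∀ {n} (i j : Fin n) → i ≢ j → (i == j) ≡ false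
≢⇒== i j i≢j with i == j in e
... | true  = ⊥-elim (i≢j (==⇒≡ i j e))
... | false = refl

FinEq : (n : ℕ) → BoolEq (Fin n)
FinEq n = record
  { eq = _==_ ; eq-refl = ==-refl
  ; eq-sym = λ a b h → ≡⇒== (≡.sym (==⇒≡ a b h))
  ; eq-trans = λ a b c h₁ h₂ → ≡⇒== (≡.trans (==⇒≡ a b h₁) (==⇒≡ b c h₂)) }

Fin-respects : ∀ {b} {n} {B : Set b} (f : Fin n → B) → Respects (FinEq n) f
Fin-respects f a b h = cong f (==⇒≡ a b h)

allFin-enumerates : ∀ n → Enumerates (FinEq n) (allFin n)
allFin-enumerates n a = ≡.trans (count≡∑ _ (allFin n)) (exactly-once n a)
  where
  exactly-once : ∀ n (a : Fin n) → ∑ℕ (λ x → ℕ∑.guard (x == a) 1) (allFin n) ≡ 1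
  exactly-once (suc n) F.zero    = ≡.trans (ℕ∑.∑-allFin-suc n (λ x → ℕ∑.guard (x == F.zero) 1)) (cong suc (ℕ∑.∑-zero (allFin n)))
  exactly-once (suc n) (F.suc a) = ≡.trans (ℕ∑.∑-allFin-suc n (λ x → ℕ∑.guard (x == F.suc a) 1)) (exactly-once n a)

allF-suc : ∀ k (p : Fin (suc k) → Bool) → allF (suc k) p ≡ p F.zero ∧ allF k (λ i → p (F.suc i))
allF-suc k p = cong (p F.zero ∧_) (foldr-tabulate k p F.suc)
  where
  foldr-tabulate : ∀ k {A : Set} (q : A → Bool) (g : Fin k → A) →
    Data.List.foldr (λ i b → q i ∧ b) true (tabulate g) ≡ Data.List.foldr (λ i b → q (g i) ∧ b) true (allFin k)
  foldr-tabulate zero    q g = refl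
  foldr-tabulate (suc k) q g = cong (q (g F.zero) ∧_)
    (≡.trans (foldr-tabulate k q (λ i → g (F.suc i))) (≡.sym (foldr-tabulate k (λ i → q (g i)) F.suc)))

allF⇒ : ∀ k (p : Fin k → Bool) → allF k p ≡ true → ∀ i → p i ≡ true
allF⇒ (suc k) p h F.zero    = ∧-proj₁ (≡.trans (≡.sym (allF-suc k p)) h)
allF⇒ (suc k) p h (F.suc i) = allF⇒ k (λ i → p (F.suc i)) (∧-proj₂ {p F.zero} (≡.trans (≡.sym (allF-suc k p)) h)) i

allF⇐ : ∀ k (p : Fin k → Bool) → (∀ i → p i ≡ true) → allF k p ≡ true
allF⇐ zero    p h = refl
allF⇐ (suc k) p h = ≡.trans (allF-suc k p) (∧-intro (h F.zero) (allF⇐ k (λ i → p (F.suc i)) (λ i → h (F.suc i))))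

allF²⇒ : ∀ k (p : Fin k → Fin k → Bool) → allF k (λ i → allF k (p i)) ≡ true → ∀ i j → p i j ≡ true
allF²⇒ k p h i = allF⇒ k (p i) (allF⇒ k (λ i → allF k (p i)) h i)

allF²⇐ : ∀ k (p : Fin k → Fin k → Bool) → (∀ i j → p i j ≡ true) → allF k (λ i → allF k (p i)) ≡ true
allF²⇐ k p h = allF⇐ k (λ i → allF k (p i)) (λ i → allF⇐ k (p i) (h i))

allF-cong : ∀ k {p q : Fin k → Bool} → (∀ i → p i ≡ q i) → allF k p ≡ allF k q
allF-cong k {p} {q} p≡q = bool-ext (λ e → allF⇐ k q (λ i → ≡.trans (≡.sym (p≡q i)) (allF⇒ k p e i)))
                                   (λ e → allF⇐ k p (λ i → ≡.trans (p≡q i) (allF⇒ k q e i)))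

FunEq : {A : Set} → BoolEq A → (k : ℕ) → BoolEq (Fin k → A)
FunEq E k = record
  { eq       = λ f g → allF k (λ i → eq (f i) (g i))
  ; eq-refl  = λ f → allF⇐ k _ (λ i → eq-refl (f i))
  ; eq-sym   = λ f g h → allF⇐ k _ (λ i → eq-sym (f i) (g i) (allF⇒ k _ h i))
  ; eq-trans = λ f g h e₁ e₂ → allF⇐ k _ (λ i → eq-trans (f i) (g i) (h i) (allF⇒ k _ e₁ i) (allF⇒ k _ e₂ i)) }
  where open BoolEq E

enumerates-∑ : {A : Set} (E : BoolEq A) (xs : List A) → Enumerates E xs →
               ∀ a → ∑ℕ (λ x → ℕ∑.guard (BoolEq.eq E x a) 1) xs ≡ 1
enumerates-∑ E xs enum a = ≡.trans (≡.sym (count≡∑ _ xs)) (enum a)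

module _ {A : Set} (E : BoolEq A) (xs : List A) (enum : Enumerates E xs) where
  open BoolEq E

  private
    allFuns-step : ∀ k (cons : A → (Fin k → A) → Fin (suc k) → A) →
      (∀ a f → cons a f F.zero ≡ a) → (∀ a f i → cons a f (F.suc i) ≡ f i) →
      Enumerates (FunEq E k) (allFuns xs k) →
      Enumerates (FunEq E (suc k)) (concatMap (λ a → map (cons a) (allFuns xs k)) xs)
    allFuns-step k cons cons-zero cons-suc IH g = ≡.trans (count≡∑ _ (concatMap (λ a → map (cons a) Fs) xs)) (begin
      ∑ℕ (λ h → [ allF (suc k) (λ i → eq (h i) (g i)) ]) (concatMap (λ a → map (cons a) Fs) xs)
        ≡⟨ ℕ∑.∑-concatMap _ _ xs ⟩
      ∑ℕ (λ a → ∑ℕ (λ h → [ allF (suc k) (λ i → eq (h i) (g i)) ]) (map (cons a) Fs)) xs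
        ≡⟨ ℕ∑.∑-cong xs (λ a → ℕ∑.∑-map _ (cons a) Fs) ⟩
      ∑ℕ (λ a → ∑ℕ (λ f → [ allF (suc k) (λ i → eq (cons a f i) (g i)) ]) Fs) xs
        ≡⟨ ℕ∑.∑-cong xs (λ a → ℕ∑.∑-cong Fs (λ f → cong [_] (split a f))) ⟩
      ∑ℕ (λ a → ∑ℕ (λ f → [ eq a (g F.zero) ∧ allF k (λ i → eq (f i) (g (F.suc i))) ]) Fs) xs
        ≡⟨ ℕ∑.∑-cong xs (λ a → ≡.trans (ℕ∑.∑-cong Fs (λ f → ℕ∑.guard-∧ (eq a (g F.zero)) _ 1))
                                       (≡.sym (ℕ∑.guard-∑ (eq a (g F.zero)) _ Fs))) ⟩
      ∑ℕ (λ a → ℕ∑.guard (eq a (g F.zero)) (∑ℕ (λ f → [ allF k (λ i → eq (f i) (g (F.suc i))) ]) Fs)) xs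
        ≡⟨ ℕ∑.∑-cong xs (λ a → cong (ℕ∑.guard (eq a (g F.zero)))
             (enumerates-∑ (FunEq E k) Fs IH (λ i → g (F.suc i)))) ⟩
      ∑ℕ (λ a → [ eq a (g F.zero) ]) xs
        ≡⟨ enumerates-∑ E xs enum (g F.zero) ⟩
      1 ∎)
      where
      open ≡.≡-Reasoning
      Fs = allFuns xs k
      [_] : Bool → ℕ
      [ b ] = ℕ∑.guard b 1
      split : ∀ a f → allF (suc k) (λ i → eq (cons a f i) (g i))
                    ≡ eq a (g F.zero) ∧ allF k (λ i → eq (f i) (g (F.suc i)))
      split a f = ≡.trans (allF-suc k _)
        (cong₂ _∧_ (cong (λ z → eq z (g F.zero)) (cons-zero a f))
                   (allF-cong k (λ i → cong (λ z → eq z (g (F.suc i))) (cons-suc a f i))))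

  allFuns-enumerates : ∀ k → Enumerates (FunEq E k) (allFuns xs k)
  allFuns-enumerates zero    g = refl
  allFuns-enumerates (suc k) = allFuns-step k _ (λ _ _ → refl) (λ _ _ _ → refl) (allFuns-enumerates k)

PairEq : {A B : Set} → BoolEq A → BoolEq B → BoolEq (A × B)
PairEq EA EB = record
  { eq       = λ x y → A.eq (proj₁ x) (proj₁ y) ∧ B.eq (proj₂ x) (proj₂ y)
  ; eq-refl  = λ x → ∧-intro (A.eq-refl _) (B.eq-refl _)
  ; eq-sym   = λ x y h → ∧-intro (A.eq-sym _ _ (∧-proj₁ h)) (B.eq-sym _ _ (∧-proj₂ {A.eq (proj₁ x) (proj₁ y)} h))
  ; eq-trans = λ x y z h₁ h₂ → ∧-intro (A.eq-trans _ _ _ (∧-proj₁ h₁) (∧-proj₁ h₂))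
      (B.eq-trans _ _ _ (∧-proj₂ {A.eq (proj₁ x) (proj₁ y)} h₁) (∧-proj₂ {A.eq (proj₁ y) (proj₁ z)} h₂)) }
  where
  module A = BoolEq EA
  module B = BoolEq EB

pairs-enumerates : {A B : Set} (EA : BoolEq A) (EB : BoolEq B) (xs : List A) (ys : List B) →
                   Enumerates EA xs → Enumerates EB ys → Enumerates (PairEq EA EB) (pairs xs ys)
pairs-enumerates EA EB xs ys enumA enumB (a₀ , b₀) = ≡.trans (count≡∑ _ (pairs xs ys)) (begin
  ∑ℕ (λ x → [ A.eq (proj₁ x) a₀ ∧ B.eq (proj₂ x) b₀ ]) (pairs xs ys)
    ≡⟨ ℕ∑.∑-pairs _ xs ys ⟩
  ∑ℕ (λ a → ∑ℕ (λ b → [ A.eq a a₀ ∧ B.eq b b₀ ]) ys) xs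
    ≡⟨ ℕ∑.∑-cong xs (λ a → ≡.trans (ℕ∑.∑-cong ys (λ b → ℕ∑.guard-∧ (A.eq a a₀) _ 1))
                                   (≡.sym (ℕ∑.guard-∑ (A.eq a a₀) _ ys))) ⟩
  ∑ℕ (λ a → ℕ∑.guard (A.eq a a₀) (∑ℕ (λ b → [ B.eq b b₀ ]) ys)) xs
    ≡⟨ ℕ∑.∑-cong xs (λ a → cong (ℕ∑.guard (A.eq a a₀)) (enumerates-∑ EB ys enumB b₀)) ⟩
  ∑ℕ (λ a → [ A.eq a a₀ ]) xs
    ≡⟨ enumerates-∑ EA xs enumA a₀ ⟩
  1 ∎)
  where
  module A = BoolEq EA
  module B = BoolEq EB
  open ≡.≡-Reasoning
  [_] : Bool → ℕ
  [ b ] = ℕ∑.guard b 1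

module PermutedSums {c ℓ} (R : CommutativeSemiring c ℓ) where
  open CommutativeSemiring R using (Carrier; _≈_)
  open FiniteSums R

  ∑-permute : ∀ {n} (π : Permutation′ n) (g : Fin n → Carrier) →
              ∑ (λ x → g (π ⟨$⟩ʳ x)) (allFin n) ≈ ∑ g (allFin n)
  ∑-permute {n} π g = Enumerated.reindex (FinEq n) (allFin n) (allFin-enumerates n)
    (π ⟨$⟩ʳ_) (π ⟨$⟩ˡ_) (preserves (π ⟨$⟩ʳ_)) (preserves (π ⟨$⟩ˡ_))
    (λ _ → true) (λ _ _ _ → refl) g (Fin-respects g) (λ _ _ → refl) (λ _ _ → refl)
    (λ _ _ → ≡⇒== (inverseˡ π)) (λ _ _ → ≡⇒== (inverseʳ π))
    where
    preserves : (h : Fin n → Fin n) → ∀ a b → (a == b) ≡ true → (h a == h b) ≡ true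
    preserves h a b a==b = ≡⇒== (cong h (==⇒≡ a b a==b))

module ℕ-permute = PermutedSums ℕP.+-*-commutativeSemiring
module 𝔽₂-permute = PermutedSums (CommutativeRing.commutativeSemiring BoolP.xor-∧-commutativeRing)

<F-irrefl : ∀ {n} (a : Fin n) → (a <F a) ≡ false
<F-irrefl a = irrefl (toℕ a)
  where
  irrefl : ∀ x → (x <ᵇ x) ≡ false
  irrefl zero    = refl
  irrefl (suc x) = irrefl x

<F-asym : ∀ {n} (a b : Fin n) → (a <F b) ≡ true → (b <F a) ≡ false
<F-asym a b = asym (toℕ a) (toℕ b)
  where
  asym : ∀ x y → (x <ᵇ y) ≡ true → (y <ᵇ x) ≡ false
  asym zero    (suc y) _ = refl
  asym (suc x) (suc y) h = asym x y h

<F-total : ∀ {n} (a b : Fin n) → a ≢ b → (a <F b) xor (b <F a) ≡ true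
<F-total a b a≢b = total (toℕ a) (toℕ b) (λ e → a≢b (FinP.toℕ-injective e))
  where
  total : ∀ x y → x ≢ y → (x <ᵇ y) xor (y <ᵇ x) ≡ true
  total zero    zero    x≢y = ⊥-elim (x≢y refl)
  total zero    (suc y) _   = refl
  total (suc x) zero    _   = refl
  total (suc x) (suc y) x≢y = total x y (λ e → x≢y (cong suc e))

<F-flip : ∀ {n} (a b : Fin n) → a ≢ b → (b <F a) ≡ not (a <F b)
<F-flip a b a≢b = xor-true (a <F b) (b <F a) (<F-total a b a≢b)
  where
  xor-true : ∀ x y → x xor y ≡ true → y ≡ not x
  xor-true true  false _ = refl
  xor-true false true  _ = refl

inversionParity : ∀ {n} → (Fin n → Fin n) → Bool
inversionParity {n} f = ⨁ (λ a → ⨁ (λ b → (a <F b) ∧ (f b <F f a)) (allFin n)) (allFin n)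

lineOdd≡inversionParity : ∀ {n} (f : Fin n → Fin n) → lineOdd f ≡ inversionParity f
lineOdd≡inversionParity {n} f =
  ≡.trans (isOdd-count _ (pairs (allFin n) (allFin n))) (𝔽₂∑.∑-pairs _ (allFin n) (allFin n))

inversionParity-cong : ∀ {n} {f g : Fin n → Fin n} → (∀ x → f x ≡ g x) →
                       inversionParity f ≡ inversionParity g
inversionParity-cong {n} f≡g = 𝔽₂∑.∑-cong (allFin n) (λ a → 𝔽₂∑.∑-cong (allFin n) (λ b →
  cong₂ (λ u v → _ ∧ (u <F v)) (f≡g b) (f≡g a)))

inversionParity-id : ∀ {n} → inversionParity {n} (λ x → x) ≡ false
inversionParity-id {n} = ≡.trans (𝔽₂∑.∑-cong (allFin n) (λ a →
  ≡.trans (𝔽₂∑.∑-cong (allFin n) (λ b → no-inversion a b)) (𝔽₂∑.∑-zero (allFin n)))) (𝔽₂∑.∑-zero (allFin n))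
  where
  no-inversion : ∀ (a b : Fin n) → ((a <F b) ∧ (b <F a)) ≡ false
  no-inversion a b with a <F b in a<b
  ... | true  = <F-asym a b a<b
  ... | false = refl

module InversionsOfComposite {n : ℕ} (σ : Fin n → Fin n) (σ-inj : ∀ a b → σ a ≡ σ b → a ≡ b)
                             (τ : Permutation′ n) where
  private
    T t : Fin n → Fin n
    T = τ ⟨$⟩ʳ_
    t = τ ⟨$⟩ˡ_
    AF = allFin n

    t-inj : ∀ a b → t a ≡ t b → a ≡ b
    t-inj a b e = ≡.trans (≡.sym (inverseʳ τ)) (≡.trans (cong T e) (inverseʳ τ))

    -- Whether t reverses the relative order of a and b; symmetric in a, b.
    X : Fin n → Fin n → Bool
    X a b = (t a <F t b) xor (a <F b)

    X-sym : ∀ a b → X a b ≡ X b a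
    X-sym a b with a F.≟ b
    ... | yes refl = refl
    ... | no a≢b = begin
      (t a <F t b) xor (a <F b)              ≡⟨ BoolP.xor-annihilates-not (t a <F t b) (a <F b) ⟨
      not (t a <F t b) xor not (a <F b)      ≡⟨ cong₂ _xor_ (<F-flip (t a) (t b) (λ e → a≢b (t-inj a b e)))
                                                            (<F-flip a b a≢b) ⟨
      (t b <F t a) xor (b <F a)              ∎
      where open ≡.≡-Reasoning

    Y : Fin n → Fin n → Bool
    Y a b = X a b ∧ (σ b <F σ a)

    substitute : inversionParity (λ x → σ (T x))
               ≡ ⨁ (λ a → ⨁ (λ b → (t a <F t b) ∧ (σ b <F σ a)) AF) AF
    substitute = begin
      ⨁ (λ p → ⨁ (λ q → (p <F q) ∧ (σ (T q) <F σ (T p))) AF) AF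
        ≡⟨ 𝔽₂-permute.∑-permute (flip τ) _ ⟨
      ⨁ (λ a → ⨁ (λ q → (t a <F q) ∧ (σ (T q) <F σ (T (t a)))) AF) AF
        ≡⟨ 𝔽₂∑.∑-cong AF (λ a → 𝔽₂-permute.∑-permute (flip τ) _) ⟨
      ⨁ (λ a → ⨁ (λ b → (t a <F t b) ∧ (σ (T (t b)) <F σ (T (t a)))) AF) AF
        ≡⟨ 𝔽₂∑.∑-cong AF (λ a → 𝔽₂∑.∑-cong AF (λ b →
             cong₂ (λ u v → (t a <F t b) ∧ (σ u <F σ v)) (inverseʳ τ) (inverseʳ τ))) ⟩
      ⨁ (λ a → ⨁ (λ b → (t a <F t b) ∧ (σ b <F σ a)) AF) AF ∎
      where open ≡.≡-Reasoning

    difference : inversionParity (λ x → σ (T x)) xor inversionParity σ ≡ ⨁ (λ a → ⨁ (Y a) AF) AF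
    difference = begin
      inversionParity (λ x → σ (T x)) xor inversionParity σ
        ≡⟨ cong (_xor inversionParity σ) substitute ⟩
      ⨁ (λ a → ⨁ (λ b → (t a <F t b) ∧ (σ b <F σ a)) AF) AF xor inversionParity σ
        ≡⟨ 𝔽₂∑.∑-+ _ _ AF ⟨
      ⨁ (λ a → ⨁ (λ b → (t a <F t b) ∧ (σ b <F σ a)) AF xor ⨁ (λ b → (a <F b) ∧ (σ b <F σ a)) AF) AF
        ≡⟨ 𝔽₂∑.∑-cong AF (λ a → ≡.trans (≡.sym (𝔽₂∑.∑-+ _ _ AF)) (𝔽₂∑.∑-cong AF (λ b →
             ≡.sym (BoolP.∧-distribʳ-xor (σ b <F σ a) (t a <F t b) (a <F b))))) ⟩
      ⨁ (λ a → ⨁ (Y a) AF) AF ∎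
      where open ≡.≡-Reasoning

    split : ∀ a b → Y a b ≡ ((a <F b) ∧ Y a b) xor ((b <F a) ∧ Y a b)
    split a b with a F.≟ b
    ... | yes refl = ≡.trans (≡.trans (cong (X a a ∧_) (<F-irrefl (σ a))) (BoolP.∧-zeroʳ (X a a)))
                       (≡.sym (cong₂ (λ u v → (u ∧ Y a a) xor (v ∧ Y a a)) (<F-irrefl a) (<F-irrefl a)))
    ... | no a≢b = ≡.trans (cong (_∧ Y a b) (≡.sym (<F-total a b a≢b)))
                           (BoolP.∧-distribʳ-xor (Y a b) (a <F b) (b <F a))

    combine : ∀ a b → ((a <F b) ∧ Y a b) xor ((a <F b) ∧ (X a b ∧ (σ a <F σ b))) ≡ ((a <F b) ∧ (t b <F t a))
    combine a b with a <F b in a<b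
    ... | false = refl
    ... | true  = begin
      (Xab ∧ (σ b <F σ a)) xor (Xab ∧ (σ a <F σ b))  ≡⟨ BoolP.∧-distribˡ-xor Xab (σ b <F σ a) (σ a <F σ b) ⟨
      Xab ∧ ((σ b <F σ a) xor (σ a <F σ b))          ≡⟨ cong (Xab ∧_) (<F-total (σ b) (σ a) (λ e → a≢b (σ-inj a b (≡.sym e)))) ⟩
      Xab ∧ true                                     ≡⟨ BoolP.∧-identityʳ Xab ⟩
      (t a <F t b) xor true                          ≡⟨ BoolP.xor-comm (t a <F t b) true ⟩
      not (t a <F t b)                               ≡⟨ <F-flip (t a) (t b) (λ e → a≢b (t-inj a b e)) ⟨
      (t b <F t a)                                   ∎
      where
      open ≡.≡-Reasoning
      Xab = (t a <F t b) xor true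
      a≢b : a ≢ b
      a≢b refl = subst (λ z → z ≡ true → ⊥) (≡.sym (<F-irrefl a)) (λ ()) a<b

    symmetrize : ⨁ (λ a → ⨁ (Y a) AF) AF ≡ inversionParity t
    symmetrize = begin
      ⨁ (λ a → ⨁ (Y a) AF) AF
        ≡⟨ 𝔽₂∑.∑-cong AF (λ a → ≡.trans (𝔽₂∑.∑-cong AF (split a)) (𝔽₂∑.∑-+ _ _ AF)) ⟩
      ⨁ (λ a → ⨁ (λ b → (a <F b) ∧ Y a b) AF xor ⨁ (λ b → (b <F a) ∧ Y a b) AF) AF
        ≡⟨ 𝔽₂∑.∑-+ _ _ AF ⟩
      ⨁ (λ a → ⨁ (λ b → (a <F b) ∧ Y a b) AF) AF xor ⨁ (λ a → ⨁ (λ b → (b <F a) ∧ Y a b) AF) AF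
        ≡⟨ cong (⨁ (λ a → ⨁ (λ b → (a <F b) ∧ Y a b) AF) AF xor_) swapped-half ⟩
      ⨁ (λ a → ⨁ (λ b → (a <F b) ∧ Y a b) AF) AF xor ⨁ (λ a → ⨁ (λ b → (a <F b) ∧ (X a b ∧ (σ a <F σ b))) AF) AF
        ≡⟨ 𝔽₂∑.∑-+ _ _ AF ⟨
      ⨁ (λ a → ⨁ (λ b → (a <F b) ∧ Y a b) AF xor ⨁ (λ b → (a <F b) ∧ (X a b ∧ (σ a <F σ b))) AF) AF
        ≡⟨ 𝔽₂∑.∑-cong AF (λ a → ≡.trans (≡.sym (𝔽₂∑.∑-+ _ _ AF)) (𝔽₂∑.∑-cong AF (combine a))) ⟩
      inversionParity t ∎
      where
      open ≡.≡-Reasoning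
      swapped-half : ⨁ (λ a → ⨁ (λ b → (b <F a) ∧ Y a b) AF) AF
                   ≡ ⨁ (λ a → ⨁ (λ b → (a <F b) ∧ (X a b ∧ (σ a <F σ b))) AF) AF
      swapped-half = ≡.trans (𝔽₂∑.∑-cong AF (λ a → 𝔽₂∑.∑-cong AF (λ b →
                       cong (λ z → (b <F a) ∧ (z ∧ (σ b <F σ a))) (X-sym a b))))
                     (𝔽₂∑.∑-swap (λ a b → (b <F a) ∧ (X b a ∧ (σ b <F σ a))) AF AF)

  composite : inversionParity (λ x → σ (T x)) xor inversionParity σ ≡ inversionParity t
  composite = ≡.trans difference symmetrize

inversionParity-inverse : ∀ {n} (τ : Permutation′ n) → inversionParity (τ ⟨$⟩ˡ_) ≡ inversionParity (τ ⟨$⟩ʳ_)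
inversionParity-inverse {n} τ = begin
  inversionParity (τ ⟨$⟩ˡ_)
    ≡⟨ InversionsOfComposite.composite (λ x → x) (λ _ _ e → e) τ ⟨
  inversionParity (τ ⟨$⟩ʳ_) xor inversionParity {n} (λ x → x)
    ≡⟨ cong (inversionParity (τ ⟨$⟩ʳ_) xor_) (inversionParity-id {n}) ⟩
  inversionParity (τ ⟨$⟩ʳ_) xor false
    ≡⟨ BoolP.xor-identityʳ _ ⟩
  inversionParity (τ ⟨$⟩ʳ_) ∎
  where open ≡.≡-Reasoning

inversionParity-∘ : ∀ {n} (σ τ : Permutation′ n) →
  inversionParity (λ x → σ ⟨$⟩ʳ (τ ⟨$⟩ʳ x)) ≡ inversionParity (σ ⟨$⟩ʳ_) xor inversionParity (τ ⟨$⟩ʳ_)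
inversionParity-∘ σ τ = solve-for (≡.trans (InversionsOfComposite.composite (σ ⟨$⟩ʳ_) σ-inj τ) (inversionParity-inverse τ))
  where
  σ-inj : ∀ a b → σ ⟨$⟩ʳ a ≡ σ ⟨$⟩ʳ b → a ≡ b
  σ-inj a b e = ≡.trans (≡.sym (inverseˡ σ)) (≡.trans (cong (σ ⟨$⟩ˡ_) e) (inverseˡ σ))
  solve-for : ∀ {x y z} → x xor y ≡ z → x ≡ y xor z
  solve-for {true}  {true}  refl = refl
  solve-for {true}  {false} refl = refl
  solve-for {false} {true}  refl = refl
  solve-for {false} {false} refl = refl

count-split : ∀ {n} (q : Fin n → Bool) b →
  count q (allFin n) ≡ ℕ∑.guard (q b) 1 ℕ.+ count (λ x → not (x == b) ∧ q x) (allFin n)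
count-split {n} q b = begin
  count q AF                                                       ≡⟨ count≡∑ q AF ⟩
  ∑ℕ (λ x → [ q x ]) AF                                            ≡⟨ ℕ∑.∑-cong AF at-b-or-not ⟩
  ∑ℕ (λ x → ℕ∑.guard (x == b) [ q x ] ℕ.+ [ not (x == b) ∧ q x ]) AF ≡⟨ ℕ∑.∑-+ _ _ AF ⟩
  ∑ℕ (λ x → ℕ∑.guard (x == b) [ q x ]) AF ℕ.+ ∑ℕ (λ x → [ not (x == b) ∧ q x ]) AF
    ≡⟨ cong₂ ℕ._+_ (ℕ∑.Enumerated.pick (FinEq n) AF (allFin-enumerates n) (λ x → [ q x ]) (Fin-respects _) b)
                   (≡.sym (count≡∑ _ AF)) ⟩
  [ q b ] ℕ.+ count (λ x → not (x == b) ∧ q x) AF                  ∎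
  where
  open ≡.≡-Reasoning
  AF = allFin n
  [_] : Bool → ℕ
  [ x ] = ℕ∑.guard x 1
  at-b-or-not : ∀ x → [ q x ] ≡ ℕ∑.guard (x == b) [ q x ] ℕ.+ [ not (x == b) ∧ q x ]
  at-b-or-not x with x == b
  ... | true  = ≡.sym (ℕP.+-identityʳ _)
  ... | false = refl

count-positive : ∀ {n} (q : Fin n → Bool) b → q b ≡ true → count q (allFin n) ≢ 0
count-positive q b qb e with ≡.trans (≡.sym (count-split q b)) e
... | e′ rewrite qb = ℕP.1+n≢0 e′

count-unique : ∀ {n} (q : Fin n → Bool) → count q (allFin n) ≡ 1 →
               ∀ a b → q a ≡ true → q b ≡ true → a ≡ b
count-unique {n} q one a b qa qb with a F.≟ b
... | yes a≡b = a≡b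
... | no a≢b  = ⊥-elim (count-positive (λ x → not (x == a) ∧ q x) b qb′ none-but-a)
  where
  qb′ : (not (b == a) ∧ q b) ≡ true
  qb′ rewrite ≢⇒== b a (λ e → a≢b (≡.sym e)) = qb
  none-but-a : count (λ x → not (x == a) ∧ q x) (allFin n) ≡ 0
  none-but-a = ℕP.+-cancelˡ-≡ 1 _ _ (≡.trans (≡.sym (≡.trans (count-split q a)
    (cong (λ z → ℕ∑.guard z 1 ℕ.+ count (λ x → not (x == a) ∧ q x) (allFin n)) qa))) one)

find : ∀ {n} → (Fin n → Bool) → Fin n → List (Fin n) → Fin n
find p d []       = d
find p d (x ∷ xs) = if p x then x else find p d xs

find-satisfies : ∀ {n} (p : Fin n → Bool) d xs → count p xs ≢ 0 → p (find p d xs) ≡ true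
find-satisfies p d []       h = ⊥-elim (h refl)
find-satisfies p d (x ∷ xs) h with p x in px
... | true  = px
... | false = find-satisfies p d xs h

find-cong : ∀ {n} {p q : Fin n → Bool} d xs → (∀ x → p x ≡ q x) → find p d xs ≡ find q d xs
find-cong d []           p≡q = refl
find-cong {q = q} d (x ∷ xs) p≡q rewrite p≡q x = cong (if q x then x else_) (find-cong d xs p≡q)

positionOf : ∀ {n} → (Fin n → Fin n) → Fin n → Fin n
positionOf {n} f s = find (λ c → f c == s) s (allFin n)

positionOf-right : ∀ {n} (f : Fin n → Fin n) y s → f y ≡ s → f (positionOf f s) ≡ s
positionOf-right {n} f y s fy≡s = ==⇒≡ _ _
  (find-satisfies (λ c → f c == s) s (allFin n) (count-positive (λ c → f c == s) y (≡⇒== fy≡s)))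

positionOf-unique : ∀ {n} (f : Fin n → Fin n) → (∀ a b → f a ≡ f b → a ≡ b) →
                    ∀ y s → f y ≡ s → positionOf f s ≡ y
positionOf-unique f f-inj y s fy≡s = f-inj _ _ (≡.trans (positionOf-right f y s fy≡s) (≡.sym fy≡s))

positionOf-cong : ∀ {n} {f g : Fin n → Fin n} → (∀ x → f x ≡ g x) → ∀ s → positionOf f s ≡ positionOf g s
positionOf-cong {n} f≡g s = find-cong s (allFin n) (λ x → cong (_== s) (f≡g x))

IsLine : ∀ {n} → (Fin n → Fin n) → Set
IsLine {n} f = ∀ s → count (λ c → f c == s) (allFin n) ≡ 1

linePermutation : ∀ {n} (f : Fin n → Fin n) → IsLine f → Permutation′ n
linePermutation {n} f line = permutation f (positionOf f)
  (λ s → ==⇒≡ _ _ (find-satisfies (λ c → f c == s) s (allFin n) (λ e → ℕP.1+n≢0 (≡.trans (≡.sym (line s)) e))))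
  (λ x → positionOf-unique f f-inj x (f x) refl)
  where
  f-inj : ∀ a b → f a ≡ f b → a ≡ b
  f-inj a b fa≡fb = count-unique (λ c → f c == f b) (line (f b)) a b (≡⇒== fa≡fb) (==-refl (f b))

==-permute : ∀ {n} (π : Permutation′ n) x s → ((π ⟨$⟩ʳ x) == s) ≡ (x == (π ⟨$⟩ˡ s))
==-permute π x s = bool-ext (λ h → ≡⇒== (≡.trans (≡.sym (inverseˡ π)) (cong (π ⟨$⟩ˡ_) (==⇒≡ _ _ h))))
                            (λ h → ≡⇒== (≡.trans (cong (π ⟨$⟩ʳ_) (==⇒≡ _ _ h)) (inverseʳ π)))

relabel-isLine : ∀ {n} (π : Permutation′ n) (f : Fin n → Fin n) → IsLine f → IsLine (λ x → π ⟨$⟩ʳ f x)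
relabel-isLine {n} π f line s = ≡.trans (count-cong (allFin n) (λ x → ==-permute π (f x) s)) (line (π ⟨$⟩ˡ s))

reposition-isLine : ∀ {n} (π : Permutation′ n) (f : Fin n → Fin n) → IsLine f → IsLine (λ x → f (π ⟨$⟩ʳ x))
reposition-isLine {n} π f line s = begin
  count (λ x → f (π ⟨$⟩ʳ x) == s) AF                    ≡⟨ count≡∑ _ AF ⟩
  ∑ℕ (λ x → ℕ∑.guard (f (π ⟨$⟩ʳ x) == s) 1) AF          ≡⟨ ℕ-permute.∑-permute π (λ x → ℕ∑.guard (f x == s) 1) ⟩
  ∑ℕ (λ x → ℕ∑.guard (f x == s) 1) AF                    ≡⟨ count≡∑ _ AF ⟨
  count (λ x → f x == s) AF                              ≡⟨ line s ⟩
  1                                                      ∎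
  where
  open ≡.≡-Reasoning
  AF = allFin n

transpose-comm : ∀ {n} (i j k : Fin n) → PC.transpose i j k ≡ PC.transpose j i k
transpose-comm i j k with k F.≟ i
transpose-comm i j k | yes refl with k F.≟ j
... | yes refl = refl
... | no _ rewrite dec-true (k F.≟ k) refl = refl
transpose-comm i j k | no k≢i with k F.≟ j
... | yes refl = refl
... | no _ rewrite dec-false (k F.≟ i) k≢i = refl

swapWith0 : ∀ {m} → Fin (suc m) → Fin (suc m) → Fin (suc m)
swapWith0 c = PC.transpose c F.zero

swapWith0-c : ∀ {m} (c : Fin (suc m)) → swapWith0 c c ≡ F.zero
swapWith0-c c rewrite dec-true (c F.≟ c) refl = refl

swapWith0-0 : ∀ {m} (c : Fin (suc m)) → swapWith0 c F.zero ≡ c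
swapWith0-0 c = transpose-comm c F.zero F.zero

swapWith0-involutive : ∀ {m} (c x : Fin (suc m)) → swapWith0 c (swapWith0 c x) ≡ x
swapWith0-involutive c x = ≡.trans (cong (swapWith0 c) (transpose-comm c F.zero x)) (PC.transpose-inverse c F.zero)

swapWith0ₚ : ∀ {m} → Fin (suc m) → Permutation′ (suc m)
swapWith0ₚ c = permutation (swapWith0 c) (swapWith0 c) (swapWith0-involutive c) (swapWith0-involutive c)

record ReducedLatin {m : ℕ} (L : Array (suc m)) : Set where
  field
    row-line  : ∀ i → IsLine (λ j → L i j)
    col-line  : ∀ j → IsLine (λ i → L i j)
    first-row : ∀ j → L F.zero j ≡ j
    first-col : ∀ i → L i F.zero ≡ i

module _ {m : ℕ} (L : Array (suc m)) where
  private
    n = suc m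
    rowOK colOK : Fin n → Fin n → Bool
    rowOK r s = count (λ c → L r c == s) (allFin n) ≡ᵇ 1
    colOK c s = count (λ r → L r c == s) (allFin n) ≡ᵇ 1
    firstRowOK firstColOK reducedOK : Fin n → Fin n → Bool
    firstRowOK r c = not (toℕ r ≡ᵇ 0) ∨ (L r c == c)
    firstColOK r c = not (toℕ c ≡ᵇ 0) ∨ (L r c == r)
    reducedOK r c = firstRowOK r c ∧ firstColOK r c

    ≡ᵇ⇒≡ : ∀ {k} → (k ≡ᵇ 1) ≡ true → k ≡ 1
    ≡ᵇ⇒≡ {k} h = ℕP.≡ᵇ⇒≡ k 1 (subst Data.Bool.T (≡.sym h) _)

    ≡⇒≡ᵇ : ∀ {k} → k ≡ 1 → (k ≡ᵇ 1) ≡ true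
    ≡⇒≡ᵇ refl = refl

  isReducedLatin⇒ : isReducedLatin L ≡ true → ReducedLatin L
  isReducedLatin⇒ h = record
    { row-line  = λ i s → ≡ᵇ⇒≡ (allF²⇒ n rowOK (∧-proj₁ latin) i s)
    ; col-line  = λ j s → ≡ᵇ⇒≡ (allF²⇒ n colOK (∧-proj₂ {allF n (λ r → allF n (rowOK r))} latin) j s)
    ; first-row = λ j → ==⇒≡ _ _ (∧-proj₁ (allF²⇒ n reducedOK reduced F.zero j))
    ; first-col = λ i → ==⇒≡ _ _ (∧-proj₂ {firstRowOK i F.zero} (allF²⇒ n reducedOK reduced i F.zero)) }
    where
    latin = ∧-proj₁ {isLatin L} h
    reduced = ∧-proj₂ {isLatin L} h

  ⇒isReducedLatin : ReducedLatin L → isReducedLatin L ≡ true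
  ⇒isReducedLatin d = ∧-intro
    (∧-intro (allF²⇐ n rowOK (λ i s → ≡⇒≡ᵇ (row-line i s))) (allF²⇐ n colOK (λ j s → ≡⇒≡ᵇ (col-line j s))))
    (allF²⇐ n reducedOK (λ r c → ∧-intro (first-row-ok r c) (first-col-ok r c)))
    where
    open ReducedLatin d
    first-row-ok : ∀ r c → firstRowOK r c ≡ true
    first-row-ok F.zero    c = ≡⇒== (first-row c)
    first-row-ok (F.suc r) c = refl
    first-col-ok : ∀ r c → firstColOK r c ≡ true
    first-col-ok r F.zero    = ≡⇒== (first-col r)
    first-col-ok r (F.suc c) = refl

_≋_ : ∀ {n} → Array n → Array n → Set
L ≋ L′ = ∀ i j → L i j ≡ L′ i j

ReducedLatin-resp : ∀ {m} {L L′ : Array (suc m)} → L ≋ L′ → ReducedLatin L → ReducedLatin L′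
ReducedLatin-resp {m} L≋L′ d = record
  { row-line  = λ i s → ≡.trans (count-cong AF (λ j → cong (_== s) (≡.sym (L≋L′ i j)))) (row-line i s)
  ; col-line  = λ j s → ≡.trans (count-cong AF (λ i → cong (_== s) (≡.sym (L≋L′ i j)))) (col-line j s)
  ; first-row = λ j → ≡.trans (≡.sym (L≋L′ F.zero j)) (first-row j)
  ; first-col = λ i → ≡.trans (≡.sym (L≋L′ i F.zero)) (first-col i) }
  where
  open ReducedLatin d
  AF = allFin (suc m)

isReducedLatin-cong : ∀ {m} {L L′ : Array (suc m)} → L ≋ L′ → isReducedLatin L ≡ isReducedLatin L′
isReducedLatin-cong {L = L} {L′} L≋L′ =
  bool-ext (λ e → ⇒isReducedLatin L′ (ReducedLatin-resp L≋L′ (isReducedLatin⇒ L e)))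
           (λ e → ⇒isReducedLatin L (ReducedLatin-resp (λ i j → ≡.sym (L≋L′ i j)) (isReducedLatin⇒ L′ e)))

rowParity colParity : ∀ {n} → Array n → Bool
rowParity {n} L = ⨁ (λ i → inversionParity (λ j → L i j)) (allFin n)
colParity {n} L = ⨁ (λ j → inversionParity (λ i → L i j)) (allFin n)

isOddSquare≡ : ∀ {n} (L : Array n) → isOddSquare L ≡ rowParity L xor colParity L
isOddSquare≡ {n} L = ≡.trans (isOdd-+ (oddRows L) (oddCols L)) (cong₂ _xor_
  (≡.trans (isOdd-count _ (allFin n)) (𝔽₂∑.∑-cong (allFin n) (λ i → lineOdd≡inversionParity (λ j → L i j))))
  (≡.trans (isOdd-count _ (allFin n)) (𝔽₂∑.∑-cong (allFin n) (λ j → lineOdd≡inversionParity (λ i → L i j)))))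

isOddSquare-cong : ∀ {n} {L L′ : Array n} → L ≋ L′ → isOddSquare L ≡ isOddSquare L′
isOddSquare-cong {n} {L} {L′} L≋L′ = ≡.trans (isOddSquare≡ L) (≡.trans (cong₂ _xor_
  (𝔽₂∑.∑-cong (allFin n) (λ i → inversionParity-cong (λ j → L≋L′ i j)))
  (𝔽₂∑.∑-cong (allFin n) (λ j → inversionParity-cong (λ i → L≋L′ i j)))) (≡.sym (isOddSquare≡ L′)))

-- The isotopy attached to a cell (r , c) of an array L of order n = m + 1.  Writing
-- ρ for row r and κ for column c (as maps position ↦ symbol) and α for the
-- transposition (0 c), relabel symbols by γ = α ∘ ρ⁻¹, rows by β = γ ∘ κ and
-- columns by α.  For reduced Latin L the result is again reduced Latin, and the
-- cell (β 0 , c) of the new square leads back to L (see IsotopyProperties).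
module Isotopy {m : ℕ} (L : Array (suc m)) (r c : Fin (suc m)) where
  α γ γ⁻¹ β β⁻¹ : Fin (suc m) → Fin (suc m)
  α = swapWith0 c
  γ x = α (positionOf (λ j → L r j) x)
  γ⁻¹ x = L r (α x)
  β i = γ (L i c)
  β⁻¹ x = positionOf (λ i → L i c) (γ⁻¹ x)

  square : Array (suc m)
  square i j = γ (L (β⁻¹ i) (α j))

  row′ : Fin (suc m)
  row′ = β F.zero

isotopy-cong : ∀ {m} {L L′ : Array (suc m)} (r c : Fin (suc m)) → L ≋ L′ →
  (Isotopy.square L r c ≋ Isotopy.square L′ r c) × (Isotopy.row′ L r c ≡ Isotopy.row′ L′ r c)
isotopy-cong {L = L} {L′} r c L≋L′ =
  (λ i j → ≡.trans (cong I.γ (L≋L′ _ _)) (≡.trans (γ≡ _) (cong (λ z → I′.γ (L′ z (I.α j))) (β⁻¹≡ i)))) ,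
  ≡.trans (γ≡ (L F.zero c)) (cong I′.γ (L≋L′ F.zero c))
  where
  module I = Isotopy L r c
  module I′ = Isotopy L′ r c
  γ≡ : ∀ x → I.γ x ≡ I′.γ x
  γ≡ x = cong I.α (positionOf-cong (λ j → L≋L′ r j) x)
  β⁻¹≡ : ∀ x → I.β⁻¹ x ≡ I′.β⁻¹ x
  β⁻¹≡ x = ≡.trans (positionOf-cong (λ i → L≋L′ i c) (I.γ⁻¹ x)) (cong (positionOf (λ i → L′ i c)) (L≋L′ r (I.α x)))

module Xor = Algebra.Properties.CommutativeSemigroup
  (CommutativeMonoid.commutativeSemigroup (CommutativeRing.+-commutativeMonoid BoolP.xor-∧-commutativeRing))

xor-cancelʳ : ∀ a b → (a xor b) xor a ≡ b
xor-cancelʳ true  true  = refl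
xor-cancelʳ true  false = refl
xor-cancelʳ false b     = BoolP.xor-identityʳ b

xor-cancelˡ : ∀ a b → a xor (a xor b) ≡ b
xor-cancelˡ a b = ≡.trans (≡.sym (BoolP.xor-assoc a a b)) (cong (_xor b) (BoolP.xor-same a))

⨁-const-odd : ∀ n (K : Bool) → isOdd n ≡ true → ⨁ (λ _ → K) (allFin n) ≡ K
⨁-const-odd n K odd = ≡.trans (𝔽₂∑.∑-const n K) (cong (_∧ K) (≡.trans (fromℕ≡isOdd n) odd))
  where
  fromℕ≡isOdd : ∀ n → 𝔽₂∑.fromℕ n ≡ isOdd n
  fromℕ≡isOdd zero    = refl
  fromℕ≡isOdd (suc n) = ≡.trans (cong not (fromℕ≡isOdd n)) (≡.sym (isOdd-suc n))

module IsotopyProperties {m : ℕ} (L : Array (suc m)) (r c : Fin (suc m)) (d : ReducedLatin L) where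
  open Isotopy L r c
  open ReducedLatin d
  private
    n = suc m
    AF = allFin n

  ρₚ κₚ αₚ γₚ βₚ : Permutation′ n
  ρₚ = linePermutation (λ j → L r j) (row-line r)
  κₚ = linePermutation (λ i → L i c) (col-line c)
  αₚ = swapWith0ₚ c
  γₚ = flip ρₚ ∘ₚ αₚ
  βₚ = κₚ ∘ₚ γₚ

  rowₚ colₚ : Fin n → Permutation′ n
  rowₚ i = linePermutation (λ j → L i j) (row-line i)
  colₚ j = linePermutation (λ i → L i j) (col-line j)

  β⁻¹-0 : β⁻¹ F.zero ≡ r
  β⁻¹-0 = ≡.trans (cong β⁻¹ (≡.sym β-r)) (inverseˡ βₚ)
    where
    β-r : β r ≡ F.zero
    β-r = ≡.trans (cong α (inverseˡ ρₚ)) (swapWith0-c c)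

  reducedLatin : ReducedLatin square
  reducedLatin = record
    { row-line  = λ i → relabel-isLine γₚ (λ j → L (β⁻¹ i) (α j)) (reposition-isLine αₚ (λ j → L (β⁻¹ i) j) (row-line (β⁻¹ i)))
    ; col-line  = λ j → relabel-isLine γₚ (λ i → L (β⁻¹ i) (α j)) (reposition-isLine (flip βₚ) (λ i → L i (α j)) (col-line (α j)))
    ; first-row = λ j → ≡.trans (cong (λ z → γ (L z (α j))) β⁻¹-0) (inverseʳ γₚ)
    ; first-col = λ i → ≡.trans (cong (λ z → γ (L (β⁻¹ i) z)) (swapWith0-0 c)) (inverseʳ βₚ) }

  γ-vs-α : inversionParity γ xor inversionParity α ≡ inversionParity (λ j → L r j)
  γ-vs-α = ≡.trans (cong (_xor inversionParity α)
                      (≡.trans (inversionParity-∘ αₚ (flip ρₚ)) (cong (inversionParity α xor_) (inversionParity-inverse ρₚ))))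
                   (xor-cancelʳ (inversionParity α) _)

  γ-vs-β : inversionParity γ xor inversionParity β ≡ inversionParity (λ i → L i c)
  γ-vs-β = ≡.trans (cong (inversionParity γ xor_) (inversionParity-∘ γₚ κₚ)) (xor-cancelˡ (inversionParity γ) _)

  module _ (odd : isOdd n ≡ true) where
    rowParity-square : rowParity square ≡ rowParity L xor inversionParity (λ j → L r j)
    rowParity-square = begin
      ⨁ (λ i → inversionParity (λ j → square i j)) AF
        ≡⟨ 𝔽₂∑.∑-cong AF (λ i → ≡.trans (inversionParity-∘ γₚ (αₚ ∘ₚ rowₚ (β⁻¹ i)))
             (≡.trans (cong (inversionParity γ xor_) (inversionParity-∘ (rowₚ (β⁻¹ i)) αₚ))
                      (Xor.x∙yz≈y∙xz (inversionParity γ) (inversionParity (λ j → L (β⁻¹ i) j)) (inversionParity α)))) ⟩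
      ⨁ (λ i → inversionParity (λ j → L (β⁻¹ i) j) xor (inversionParity γ xor inversionParity α)) AF
        ≡⟨ 𝔽₂∑.∑-+ (λ i → inversionParity (λ j → L (β⁻¹ i) j)) (λ _ → inversionParity γ xor inversionParity α) AF ⟩
      ⨁ (λ i → inversionParity (λ j → L (β⁻¹ i) j)) AF xor ⨁ (λ _ → inversionParity γ xor inversionParity α) AF
        ≡⟨ cong₂ _xor_ (𝔽₂-permute.∑-permute (flip βₚ) (λ i → inversionParity (λ j → L i j)))
                       (≡.trans (⨁-const-odd n _ odd) γ-vs-α) ⟩
      rowParity L xor inversionParity (λ j → L r j) ∎
      where open ≡.≡-Reasoning

    colParity-square : colParity square ≡ colParity L xor inversionParity (λ i → L i c)
    colParity-square = begin
      ⨁ (λ j → inversionParity (λ i → square i j)) AF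
        ≡⟨ 𝔽₂∑.∑-cong AF (λ j → ≡.trans (inversionParity-∘ γₚ (flip βₚ ∘ₚ colₚ (α j)))
             (≡.trans (cong (inversionParity γ xor_) (≡.trans (inversionParity-∘ (colₚ (α j)) (flip βₚ))
                                                          (cong (inversionParity (λ i → L i (α j)) xor_) (inversionParity-inverse βₚ))))
                      (Xor.x∙yz≈y∙xz (inversionParity γ) (inversionParity (λ i → L i (α j))) (inversionParity β)))) ⟩
      ⨁ (λ j → inversionParity (λ i → L i (α j)) xor (inversionParity γ xor inversionParity β)) AF
        ≡⟨ 𝔽₂∑.∑-+ (λ j → inversionParity (λ i → L i (α j))) (λ _ → inversionParity γ xor inversionParity β) AF ⟩
      ⨁ (λ j → inversionParity (λ i → L i (α j))) AF xor ⨁ (λ _ → inversionParity γ xor inversionParity β) AF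
        ≡⟨ cong₂ _xor_ (𝔽₂-permute.∑-permute αₚ (λ j → inversionParity (λ i → L i j)))
                       (≡.trans (⨁-const-odd n _ odd) γ-vs-β) ⟩
      colParity L xor inversionParity (λ i → L i c) ∎
      where open ≡.≡-Reasoning

    isOddSquare-square : isOddSquare square ≡ isOddSquare L xor (lineOdd (λ j → L r j) xor lineOdd (λ i → L i c))
    isOddSquare-square = begin
      isOddSquare square
        ≡⟨ isOddSquare≡ square ⟩
      rowParity square xor colParity square
        ≡⟨ cong₂ _xor_ rowParity-square colParity-square ⟩
      (rowParity L xor inversionParity (λ j → L r j)) xor (colParity L xor inversionParity (λ i → L i c))
        ≡⟨ Xor.interchange (rowParity L) (inversionParity (λ j → L r j)) (colParity L) (inversionParity (λ i → L i c)) ⟩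
      (rowParity L xor colParity L) xor (inversionParity (λ j → L r j) xor inversionParity (λ i → L i c))
        ≡⟨ cong₂ _xor_ (isOddSquare≡ L) (cong₂ _xor_ (lineOdd≡inversionParity (λ j → L r j)) (lineOdd≡inversionParity (λ i → L i c))) ⟨
      isOddSquare L xor (lineOdd (λ j → L r j) xor lineOdd (λ i → L i c)) ∎
      where open ≡.≡-Reasoning

  -- The isotopy of the new square at the cell (β 0 , c) undoes the first one.
  module J = Isotopy square row′ c

  private
    Jrow : ∀ j → square row′ j ≡ γ (α j)
    Jrow j = ≡.trans (cong (λ z → γ (L z (α j))) (inverseˡ βₚ)) (cong γ (first-row (α j)))

    Jγ : ∀ x → J.γ x ≡ γ⁻¹ x
    Jγ x = ≡.trans (cong α (positionOf-unique (λ j → square row′ j) inj (α (γ⁻¹ x)) x hit)) (swapWith0-involutive c (γ⁻¹ x))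
      where
      inj : ∀ a b → square row′ a ≡ square row′ b → a ≡ b
      inj a b e = ≡.trans (≡.sym (inverseˡ (αₚ ∘ₚ γₚ))) (≡.trans (cong (flip (αₚ ∘ₚ γₚ) ⟨$⟩ʳ_)
                    (≡.trans (≡.sym (Jrow a)) (≡.trans e (Jrow b)))) (inverseˡ (αₚ ∘ₚ γₚ)))
      hit : square row′ (α (γ⁻¹ x)) ≡ x
      hit = ≡.trans (Jrow (α (γ⁻¹ x))) (≡.trans (cong γ (swapWith0-involutive c (γ⁻¹ x))) (inverseʳ γₚ))

    Jγ⁻¹ : ∀ x → J.γ⁻¹ x ≡ γ x
    Jγ⁻¹ x = ≡.trans (Jrow (α x)) (cong γ (swapWith0-involutive c x))

    Jcol : ∀ i → square i c ≡ γ (β⁻¹ i)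
    Jcol i = ≡.trans (cong (λ z → γ (L (β⁻¹ i) z)) (swapWith0-c c)) (cong γ (first-col (β⁻¹ i)))

    Jβ⁻¹ : ∀ x → J.β⁻¹ x ≡ β x
    Jβ⁻¹ x = positionOf-unique (λ i → square i c) inj (β x) (J.γ⁻¹ x) hit
      where
      inj : ∀ a b → square a c ≡ square b c → a ≡ b
      inj a b e = ≡.trans (≡.sym (inverseˡ (flip βₚ ∘ₚ γₚ))) (≡.trans (cong (flip (flip βₚ ∘ₚ γₚ) ⟨$⟩ʳ_)
                    (≡.trans (≡.sym (Jcol a)) (≡.trans e (Jcol b)))) (inverseˡ (flip βₚ ∘ₚ γₚ)))
      hit : square (β x) c ≡ J.γ⁻¹ x
      hit = ≡.trans (Jcol (β x)) (≡.trans (cong γ (inverseˡ βₚ)) (≡.sym (Jγ⁻¹ x)))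

  involutive-square : J.square ≋ L
  involutive-square i j = begin
    J.γ (square (J.β⁻¹ i) (α j))                 ≡⟨ Jγ (square (J.β⁻¹ i) (α j)) ⟩
    γ⁻¹ (square (J.β⁻¹ i) (α j))                 ≡⟨ cong (λ z → γ⁻¹ (square z (α j))) (Jβ⁻¹ i) ⟩
    γ⁻¹ (γ (L (β⁻¹ (β i)) (α (α j))))            ≡⟨ inverseˡ γₚ ⟩
    L (β⁻¹ (β i)) (α (α j))                      ≡⟨ cong₂ L (inverseˡ βₚ) (swapWith0-involutive c j) ⟩
    L i j                                        ∎
    where open ≡.≡-Reasoning

  involutive-row : J.row′ ≡ r
  involutive-row = begin
    J.γ (square F.zero c)        ≡⟨ Jγ (square F.zero c) ⟩
    γ⁻¹ (square F.zero c)        ≡⟨ cong γ⁻¹ (Jcol F.zero) ⟩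
    γ⁻¹ (γ (β⁻¹ F.zero))         ≡⟨ inverseˡ γₚ ⟩
    β⁻¹ F.zero                   ≡⟨ β⁻¹-0 ⟩
    r                            ∎
    where open ≡.≡-Reasoning

sign : Bool → ℤ
sign b = if b then -1ℤ else 1ℤ

sign-xor : ∀ a b → sign (a xor b) ≡ sign a ℤ.* sign b
sign-xor true  true  = refl
sign-xor true  false = refl
sign-xor false true  = refl
sign-xor false false = refl

sign-not : ∀ b → sign (not b) ≡ ℤ.- sign b
sign-not true  = refl
sign-not false = refl

fromℕ≡+ : ∀ k → ℤ∑.fromℕ k ≡ + k
fromℕ≡+ zero    = refl
fromℕ≡+ (suc k) = cong (λ z → 1ℤ ℤ.+ z) (fromℕ≡+ k)

+count≡∑ : ∀ {A : Set} (p : A → Bool) (xs : List A) → + count p xs ≡ ∑ℤ (λ x → guard (p x) 1ℤ) xs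
+count≡∑ p xs = ≡.sym (≡.trans (ℤ∑.∑-count p xs) (fromℕ≡+ (count p xs)))

+double : ∀ o → + (2 ℕ.* o) ≡ + o ℤ.+ + o
+double o = ≡.trans (cong (λ z → + (o ℕ.+ z)) (ℕP.+-identityʳ o)) (ℤP.pos-+ o o)

∑-sign : ∀ {A : Set} (p : A → Bool) (xs : List A) →
         ∑ℤ (λ x → sign (p x)) xs ≡ + length xs ℤ.- (+ count p xs ℤ.+ + count p xs)
∑-sign p []       = refl
∑-sign p (x ∷ xs) with p x
... | true  = ≡.trans (cong (λ z → -1ℤ ℤ.+ z) (∑-sign p xs)) (one-more-negative (+ length xs) (+ count p xs))
  where
  one-more-negative : ∀ (L C : ℤ) → -1ℤ ℤ.+ (L ℤ.- (C ℤ.+ C)) ≡ (1ℤ ℤ.+ L) ℤ.- ((1ℤ ℤ.+ C) ℤ.+ (1ℤ ℤ.+ C))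
  one-more-negative = solve-∀
... | false = ≡.trans (cong (λ z → 1ℤ ℤ.+ z) (∑-sign p xs)) (one-more-positive (+ length xs) (+ count p xs))
  where
  one-more-positive : ∀ (L C : ℤ) → 1ℤ ℤ.+ (L ℤ.- (C ℤ.+ C)) ≡ (1ℤ ℤ.+ L) ℤ.- (C ℤ.+ C)
  one-more-positive = solve-∀

∑-sign-Fin : ∀ {n} (p : Fin n → Bool) → ∑ℤ (λ x → sign (p x)) (allFin n) ≡ + n ℤ.- + (2 ℕ.* count p (allFin n))
∑-sign-Fin {n} p = ≡.trans (∑-sign p (allFin n)) (cong₂ (λ l d → + l ℤ.- d)
  (ListP.length-tabulate {n = n} (λ x → x)) (≡.sym (+double (count p (allFin n)))))

weight : ℕ → ℕ → ℤ
weight n o = sign (isOdd o) ℤ.* (+ n ℤ.- + (2 ℕ.* o))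

rowSignSum colSignSum : ∀ {n} → Array n → ℤ
rowSignSum {n} L = ∑ℤ (λ r → sign (lineOdd (λ c → L r c))) (allFin n)
colSignSum {n} L = ∑ℤ (λ c → sign (lineOdd (λ r → L r c))) (allFin n)

signed-line-sums : ∀ {n} (L : Array n) →
  sign (isOddSquare L) ℤ.* (rowSignSum L ℤ.* colSignSum L) ≡ weight n (oddRows L) ℤ.* weight n (oddCols L)
signed-line-sums {n} L = begin
  sign (isOddSquare L) ℤ.* (rowSignSum L ℤ.* colSignSum L)
    ≡⟨ cong₂ ℤ._*_ (≡.trans (cong sign (isOdd-+ a b)) (sign-xor (isOdd a) (isOdd b)))
                   (cong₂ ℤ._*_ (∑-sign-Fin (λ r → lineOdd (λ c → L r c))) (∑-sign-Fin (λ c → lineOdd (λ r → L r c)))) ⟩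
  (sign (isOdd a) ℤ.* sign (isOdd b)) ℤ.* ((+ n ℤ.- + (2 ℕ.* a)) ℤ.* (+ n ℤ.- + (2 ℕ.* b)))
    ≡⟨ regroup (sign (isOdd a)) (sign (isOdd b)) (+ n ℤ.- + (2 ℕ.* a)) (+ n ℤ.- + (2 ℕ.* b)) ⟩
  weight n a ℤ.* weight n b ∎
  where
  open ≡.≡-Reasoning
  a = oddRows L
  b = oddCols L
  regroup : ∀ (s t x y : ℤ) → (s ℤ.* t) ℤ.* (x ℤ.* y) ≡ (s ℤ.* x) ℤ.* (t ℤ.* y)
  regroup = solve-∀

<ᵇ⇒< : ∀ {a b} → (a <ᵇ b) ≡ true → a ℕ.< b
<ᵇ⇒< {a} {b} h = ℕP.<ᵇ⇒< a b (Equivalence.from BoolP.T-≡ h)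

<⇒<ᵇ : ∀ {a b} → a ℕ.< b → (a <ᵇ b) ≡ true
<⇒<ᵇ a<b = Equivalence.to BoolP.T-≡ (ℕP.<⇒<ᵇ a<b)

≮⇒<ᵇ : ∀ {a b} → ¬ a ℕ.< b → (a <ᵇ b) ≡ false
≮⇒<ᵇ {a} {b} a≮b with a <ᵇ b in e
... | true  = ⊥-elim (a≮b (<ᵇ⇒< e))
... | false = refl

≡ᵇ⇒≡ : ∀ {a b} → (a ≡ᵇ b) ≡ true → a ≡ b
≡ᵇ⇒≡ {a} {b} h = ℕP.≡ᵇ⇒≡ a b (Equivalence.from BoolP.T-≡ h)

≡⇒≡ᵇ : ∀ {a b} → a ≡ b → (a ≡ᵇ b) ≡ true
≡⇒≡ᵇ {a} refl = Equivalence.to BoolP.T-≡ (ℕP.≡⇒≡ᵇ a a refl)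

∨-elim : ∀ {a b} → a ∨ b ≡ true → a ≡ true ⊎ b ≡ true
∨-elim {true}  _ = inj₁ refl
∨-elim {false} h = inj₂ h

double : ∀ o → 2 ℕ.* o ≡ o ℕ.+ o
double o = cong (o ℕ.+_) (ℕP.+-identityʳ o)

-- For odd n, a square with o odd lines of one kind has exactly one parity type k
-- with 2k < n, namely o or n − o; summing weights over the types leaves weight n o.
module HalfRange (n : ℕ) (odd : isOdd n ≡ true) where

  ∑-halfRange-unique : (q : ℕ → Bool) (f : ℕ → ℤ) (k₀ : ℕ) → 2 ℕ.* k₀ ℕ.< n →
    (∀ k → ((2 ℕ.* k <ᵇ n) ∧ q k) ≡ (k ≡ᵇ k₀)) →
    ∑ℤ (λ k → guard (q k) (f k)) (halfRange n) ≡ f k₀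
  ∑-halfRange-unique q f k₀ 2k₀<n only-k₀ = begin
    ∑ℤ (λ k → guard (q k) (f k)) (halfRange n)
      ≡⟨ ∑-filter (upTo n) ⟩
    ∑ℤ (λ k → guard (2 ℕ.* k <ᵇ n) (guard (q k) (f k))) (upTo n)
      ≡⟨ ℤ∑.∑-cong (upTo n) (λ k → ≡.trans (≡.sym (ℤ∑.guard-∧ (2 ℕ.* k <ᵇ n) (q k) (f k)))
                                           (cong (λ b → guard b (f k)) (only-k₀ k))) ⟩
    ∑ℤ (λ k → guard (k ≡ᵇ k₀) (f k)) (upTo n)
      ≡⟨ ∑-applyUpTo (λ k → k) n ⟩
    ∑ℤ (λ i → guard (toℕ i ≡ᵇ k₀) (f (toℕ i))) (allFin n)
      ≡⟨ ℤ∑.∑-cong (allFin n) (λ i → cong (λ z → guard (toℕ i ≡ᵇ z) (f (toℕ i))) (≡.sym (FinP.toℕ-fromℕ< k₀<n))) ⟩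
    ∑ℤ (λ i → guard (i == F.fromℕ< k₀<n) (f (toℕ i))) (allFin n)
      ≡⟨ ℤ∑.Enumerated.pick (FinEq n) (allFin n) (allFin-enumerates n) (λ i → f (toℕ i)) (Fin-respects _) (F.fromℕ< k₀<n) ⟩
    f (toℕ (F.fromℕ< k₀<n))
      ≡⟨ cong f (FinP.toℕ-fromℕ< k₀<n) ⟩
    f k₀ ∎
    where
    open ≡.≡-Reasoning
    k₀<n : k₀ ℕ.< n
    k₀<n = ℕP.≤-<-trans (ℕP.m≤m+n k₀ (k₀ ℕ.+ 0)) 2k₀<n
    ∑-filter : ∀ xs → ∑ℤ (λ k → guard (q k) (f k)) (Data.List.filterᵇ (λ k → 2 ℕ.* k <ᵇ n) xs)
                    ≡ ∑ℤ (λ k → guard (2 ℕ.* k <ᵇ n) (guard (q k) (f k))) xs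
    ∑-filter []       = refl
    ∑-filter (x ∷ xs) with 2 ℕ.* x <ᵇ n
    ... | true  = cong (λ z → guard (q x) (f x) ℤ.+ z) (∑-filter xs)
    ... | false = ≡.trans (∑-filter xs) (≡.sym (ℤP.+-identityˡ _))
    ∑-applyUpTo : ∀ (h : ℕ → ℕ) m → ∑ℤ (λ k → guard (k ≡ᵇ k₀) (f k)) (Data.List.applyUpTo h m)
                                 ≡ ∑ℤ (λ i → guard (h (toℕ i) ≡ᵇ k₀) (f (h (toℕ i)))) (allFin m)
    ∑-applyUpTo h zero    = refl
    ∑-applyUpTo h (suc m) = ≡.trans (cong (λ z → guard (h 0 ≡ᵇ k₀) (f (h 0)) ℤ.+ z) (∑-applyUpTo (λ k → h (suc k)) m))
                                    (≡.sym (ℤ∑.∑-allFin-suc m (λ i → guard (h (toℕ i) ≡ᵇ k₀) (f (h (toℕ i))))))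

  -- Twice a number is even, hence never the odd n.
  2*≢n : ∀ o → 2 ℕ.* o ≢ n
  2*≢n o e with (begin
      false                    ≡⟨ BoolP.xor-same (isOdd o) ⟨
      isOdd o xor isOdd o      ≡⟨ isOdd-+ o o ⟨
      isOdd (o ℕ.+ o)          ≡⟨ cong isOdd (≡.trans (≡.sym (double o)) e) ⟩
      isOdd n                  ≡⟨ odd ⟩
      true                     ∎)
    where open ≡.≡-Reasoning
  ... | ()

  type-small : ∀ o → 2 ℕ.* o ℕ.< n → ∀ k → ((2 ℕ.* k <ᵇ n) ∧ typeMatches n o k) ≡ (k ≡ᵇ o)
  type-small o 2o<n k = bool-ext forth back
    where
    forth : ((2 ℕ.* k <ᵇ n) ∧ typeMatches n o k) ≡ true → (k ≡ᵇ o) ≡ true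
    forth h with ∨-elim {o ≡ᵇ k} (∧-proj₂ {not (n <ᵇ 2 ℕ.* k)} (∧-proj₂ {2 ℕ.* k <ᵇ n} h))
    ... | inj₁ o≡k = ≡⇒≡ᵇ (≡.sym (≡ᵇ⇒≡ {o} {k} o≡k))
    ... | inj₂ o+k≡n = ⊥-elim (ℕP.<-irrefl (≡ᵇ⇒≡ o+k≡n) o+k<n)
      where
      2[o+k]<2n : 2 ℕ.* (o ℕ.+ k) ℕ.< 2 ℕ.* n
      2[o+k]<2n = ≡.subst₂ ℕ._<_ (≡.sym (ℕP.*-distribˡ-+ 2 o k)) (≡.sym (double n))
                    (ℕP.+-mono-< 2o<n (<ᵇ⇒< (∧-proj₁ h)))
      o+k<n : o ℕ.+ k ℕ.< n
      o+k<n = ℕP.*-cancelˡ-< 2 (o ℕ.+ k) n 2[o+k]<2n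
    back : (k ≡ᵇ o) ≡ true → ((2 ℕ.* k <ᵇ n) ∧ typeMatches n o k) ≡ true
    back h with ≡ᵇ⇒≡ {k} {o} h
    ... | refl = ∧-intro (<⇒<ᵇ 2o<n) (∧-intro (cong not (≮⇒<ᵇ (ℕP.<-asym 2o<n))) (cong (_∨ ((k ℕ.+ k) ≡ᵇ n)) (≡⇒≡ᵇ {k} refl)))

  complement-small : ∀ o → n ℕ.< 2 ℕ.* o → o ℕ.≤ n → 2 ℕ.* (n ℕ.∸ o) ℕ.< n
  complement-small o n<2o o≤n = ≡.subst₂ ℕ._<_ (≡.sym (double (n ℕ.∸ o))) (≡.trans (ℕP.+-comm (n ℕ.∸ o) o) o+k′≡n)
                                         (ℕP.+-monoʳ-< (n ℕ.∸ o) k′<o)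
    where
    o+k′≡n : o ℕ.+ (n ℕ.∸ o) ≡ n
    o+k′≡n = ℕP.m+[n∸m]≡n o≤n
    k′<o : n ℕ.∸ o ℕ.< o
    k′<o = ℕP.+-cancelˡ-< o (n ℕ.∸ o) o (≡.subst₂ ℕ._<_ (≡.sym o+k′≡n) (double o) n<2o)

  type-large : ∀ o → n ℕ.< 2 ℕ.* o → o ℕ.≤ n →
               ∀ k → ((2 ℕ.* k <ᵇ n) ∧ typeMatches n o k) ≡ (k ≡ᵇ (n ℕ.∸ o))
  type-large o n<2o o≤n k = bool-ext forth back
    where
    o+k′≡n : o ℕ.+ (n ℕ.∸ o) ≡ n
    o+k′≡n = ℕP.m+[n∸m]≡n o≤n
    2k′<n : 2 ℕ.* (n ℕ.∸ o) ℕ.< n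
    2k′<n = complement-small o n<2o o≤n
    forth : ((2 ℕ.* k <ᵇ n) ∧ typeMatches n o k) ≡ true → (k ≡ᵇ (n ℕ.∸ o)) ≡ true
    forth h with ∨-elim {o ≡ᵇ k} (∧-proj₂ {not (n <ᵇ 2 ℕ.* k)} (∧-proj₂ {2 ℕ.* k <ᵇ n} h))
    ... | inj₁ o≡k = ⊥-elim (ℕP.<-asym n<2o (≡.subst (λ z → 2 ℕ.* z ℕ.< n) (≡.sym (≡ᵇ⇒≡ {o} {k} o≡k)) (<ᵇ⇒< (∧-proj₁ h))))
    ... | inj₂ o+k≡n = ≡⇒≡ᵇ (≡.trans (≡.sym (ℕP.m+n∸m≡n o k)) (cong (ℕ._∸ o) (≡ᵇ⇒≡ o+k≡n)))
    back : (k ≡ᵇ (n ℕ.∸ o)) ≡ true → ((2 ℕ.* k <ᵇ n) ∧ typeMatches n o k) ≡ true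
    back h with ≡ᵇ⇒≡ {k} {n ℕ.∸ o} h
    ... | refl = ∧-intro (<⇒<ᵇ 2k′<n) (∧-intro (cong not (≮⇒<ᵇ (ℕP.<-asym 2k′<n)))
                   (≡.trans (cong ((o ≡ᵇ k) ∨_) (≡⇒≡ᵇ o+k′≡n)) (BoolP.∨-zeroʳ _)))

  weight-complement : ∀ o → o ℕ.≤ n → weight n (n ℕ.∸ o) ≡ weight n o
  weight-complement o o≤n = begin
    sign (isOdd k′) ℤ.* (+ n ℤ.- + (2 ℕ.* k′))
      ≡⟨ cong₂ (λ s m → sign s ℤ.* (+ m ℤ.- + (2 ℕ.* k′))) k′-parity (≡.sym o+k′≡n) ⟩
    sign (not (isOdd o)) ℤ.* (+ (o ℕ.+ k′) ℤ.- + (2 ℕ.* k′))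
      ≡⟨ cong₂ (λ s m → s ℤ.* (m ℤ.- + (2 ℕ.* k′))) (sign-not (isOdd o)) (ℤP.pos-+ o k′) ⟩
    (ℤ.- sign (isOdd o)) ℤ.* ((+ o ℤ.+ + k′) ℤ.- + (2 ℕ.* k′))
      ≡⟨ cong (λ z → (ℤ.- sign (isOdd o)) ℤ.* ((+ o ℤ.+ + k′) ℤ.- z)) (+double k′) ⟩
    (ℤ.- sign (isOdd o)) ℤ.* ((+ o ℤ.+ + k′) ℤ.- (+ k′ ℤ.+ + k′))
      ≡⟨ reflect (sign (isOdd o)) (+ o) (+ k′) ⟩
    sign (isOdd o) ℤ.* ((+ o ℤ.+ + k′) ℤ.- (+ o ℤ.+ + o))
      ≡⟨ cong₂ (λ m d → sign (isOdd o) ℤ.* (m ℤ.- d)) (≡.trans (≡.sym (ℤP.pos-+ o k′)) (cong +_ o+k′≡n)) (≡.sym (+double o)) ⟩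
    sign (isOdd o) ℤ.* (+ n ℤ.- + (2 ℕ.* o)) ∎
    where
    open ≡.≡-Reasoning
    k′ = n ℕ.∸ o
    o+k′≡n : o ℕ.+ k′ ≡ n
    o+k′≡n = ℕP.m+[n∸m]≡n o≤n
    k′-parity : isOdd k′ ≡ not (isOdd o)
    k′-parity with isOdd o | isOdd k′ | ≡.trans (≡.sym (isOdd-+ o k′)) (≡.trans (cong isOdd o+k′≡n) odd)
    ... | true  | false | _ = refl
    ... | false | true  | _ = refl
    reflect : ∀ (s O K : ℤ) → (ℤ.- s) ℤ.* ((O ℤ.+ K) ℤ.- (K ℤ.+ K)) ≡ s ℤ.* ((O ℤ.+ K) ℤ.- (O ℤ.+ O))
    reflect = solve-∀

  ∑-types : ∀ o → o ℕ.≤ n → ∑ℤ (λ k → guard (typeMatches n o k) (weight n k)) (halfRange n) ≡ weight n o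
  ∑-types o o≤n with 2 ℕ.* o ℕ.<? n
  ... | yes 2o<n = ∑-halfRange-unique (typeMatches n o) (weight n) o 2o<n (type-small o 2o<n)
  ... | no 2o≮n = ≡.trans (∑-halfRange-unique (typeMatches n o) (weight n) (n ℕ.∸ o) (complement-small o n<2o o≤n)
                                               (type-large o n<2o o≤n))
                          (weight-complement o o≤n)
    where
    n<2o : n ℕ.< 2 ℕ.* o
    n<2o = ℕP.≤∧≢⇒< (ℕP.≮⇒≥ 2o≮n) (λ e → 2*≢n o (≡.sym e))

count-≤ : ∀ {A : Set} (p : A → Bool) (xs : List A) → count p xs ℕ.≤ length xs
count-≤ p []       = ℕ.z≤n
count-≤ p (x ∷ xs) with p x
... | true  = ℕ.s≤s (count-≤ p xs)
... | false = ℕP.m≤n⇒m≤1+n (count-≤ p xs)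

count-≤-Fin : ∀ {n} (p : Fin n → Bool) → count p (allFin n) ℕ.≤ n
count-≤-Fin {n} p = subst (count p (allFin n) ℕ.≤_) (ListP.length-tabulate {n = n} (λ x → x)) (count-≤ p (allFin n))

sumZ≡∑ : ∀ xs → sumZ xs ≡ ∑ℤ (λ z → z) xs
sumZ≡∑ []       = refl
sumZ≡∑ (x ∷ xs) = cong (λ z → x ℤ.+ z) (sumZ≡∑ xs)

guard-∑∑ : ∀ {A B : Set} (b : Bool) (F : A → B → ℤ) (xs : List A) (ys : List B) →
           ∑ℤ (λ x → ∑ℤ (λ y → guard b (F x y)) ys) xs ≡ guard b (∑ℤ (λ x → ∑ℤ (F x) ys) xs)
guard-∑∑ b F xs ys = ≡.trans (ℤ∑.∑-cong xs (λ x → ≡.sym (ℤ∑.guard-∑ b (F x) ys)))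
                             (≡.sym (ℤ∑.guard-∑ b (λ x → ∑ℤ (F x) ys) xs))

module MainIdentity (m : ℕ) (odd : isOdd (suc m) ≡ true) where
  private
    n = suc m
    AF = allFin n
    arrays = allArrays n

  term≡∑ : ∀ k l → term n k l ≡ ∑ℤ (λ L → guard (isReducedLatin L)
             (guard (typeMatches n (oddRows L) k) (weight n k) ℤ.* guard (typeMatches n (oddCols L) l) (weight n l))) arrays
  term≡∑ k l = begin
    ((sign (isOdd (k ℕ.+ l)) ℤ.* A) ℤ.* B) ℤ.* + N n k l
      ≡⟨ cong (λ s → ((s ℤ.* A) ℤ.* B) ℤ.* + N n k l) (≡.trans (cong sign (isOdd-+ k l)) (sign-xor (isOdd k) (isOdd l))) ⟩
    (((sign (isOdd k) ℤ.* sign (isOdd l)) ℤ.* A) ℤ.* B) ℤ.* + N n k l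
      ≡⟨ cong₂ ℤ._*_ (regroup (sign (isOdd k)) (sign (isOdd l)) A B) (+count≡∑ _ arrays) ⟩
    (weight n k ℤ.* weight n l) ℤ.* ∑ℤ (λ L → guard (isReducedLatin L ∧ hasParityType L k l) 1ℤ) arrays
      ≡⟨ ℤ∑.∑-*ˡ (weight n k ℤ.* weight n l) _ arrays ⟩
    ∑ℤ (λ L → (weight n k ℤ.* weight n l) ℤ.* guard (isReducedLatin L ∧ hasParityType L k l) 1ℤ) arrays
      ≡⟨ ℤ∑.∑-cong arrays (λ L → guards (isReducedLatin L) (typeMatches n (oddRows L) k)
                                        (typeMatches n (oddCols L) l) (weight n k) (weight n l)) ⟩
    ∑ℤ (λ L → guard (isReducedLatin L)
         (guard (typeMatches n (oddRows L) k) (weight n k) ℤ.* guard (typeMatches n (oddCols L) l) (weight n l))) arrays ∎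
    where
    open ≡.≡-Reasoning
    A = + n ℤ.- + (2 ℕ.* k)
    B = + n ℤ.- + (2 ℕ.* l)
    regroup : ∀ (s t x y : ℤ) → ((s ℤ.* t) ℤ.* x) ℤ.* y ≡ (s ℤ.* x) ℤ.* (t ℤ.* y)
    regroup = solve-∀
    guards : ∀ a b c (u v : ℤ) → (u ℤ.* v) ℤ.* guard (a ∧ (b ∧ c)) 1ℤ ≡ guard a (guard b u ℤ.* guard c v)
    guards false b     c     u v = ℤP.*-zeroʳ (u ℤ.* v)
    guards true  false c     u v = ℤP.*-zeroʳ (u ℤ.* v)
    guards true  true  false u v = ≡.trans (ℤP.*-zeroʳ (u ℤ.* v)) (≡.sym (ℤP.*-zeroʳ u))
    guards true  true  true  u v = ℤP.*-identityʳ (u ℤ.* v)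

  paritySum≡∑weights : paritySum n ≡ ∑ℤ (λ L → guard (isReducedLatin L) (weight n (oddRows L) ℤ.* weight n (oddCols L))) arrays
  paritySum≡∑weights = begin
    paritySum n
      ≡⟨ sumZ≡∑ (concatMap (λ k → map (term n k) H) H) ⟩
    ∑ℤ (λ z → z) (concatMap (λ k → map (term n k) H) H)
      ≡⟨ ≡.trans (ℤ∑.∑-concatMap (λ z → z) (λ k → map (term n k) H) H) (ℤ∑.∑-cong H (λ k → ℤ∑.∑-map (λ z → z) (term n k) H)) ⟩
    ∑ℤ (λ k → ∑ℤ (λ l → term n k l) H) H
      ≡⟨ ℤ∑.∑-cong H (λ k → ℤ∑.∑-cong H (λ l → term≡∑ k l)) ⟩
    ∑ℤ (λ k → ∑ℤ (λ l → ∑ℤ (G k l) arrays) H) H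
      ≡⟨ ≡.trans (ℤ∑.∑-cong H (λ k → ℤ∑.∑-swap (G k) H arrays)) (ℤ∑.∑-swap (λ k L → ∑ℤ (λ l → G k l L) H) H arrays) ⟩
    ∑ℤ (λ L → ∑ℤ (λ k → ∑ℤ (λ l → G k l L) H) H) arrays
      ≡⟨ ℤ∑.∑-cong arrays (λ L → ≡.trans (guard-∑∑ (isReducedLatin L) _ H H)
           (cong (guard (isReducedLatin L)) (ℤ∑.∑-product (rowType L) (colType L) H H))) ⟩
    ∑ℤ (λ L → guard (isReducedLatin L) (∑ℤ (rowType L) H ℤ.* ∑ℤ (colType L) H)) arrays
      ≡⟨ ℤ∑.∑-cong arrays (λ L → cong (guard (isReducedLatin L)) (cong₂ ℤ._*_
           (∑-types (oddRows L) (count-≤-Fin (λ r → lineOdd (λ c → L r c))))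
           (∑-types (oddCols L) (count-≤-Fin (λ c → lineOdd (λ r → L r c)))))) ⟩
    ∑ℤ (λ L → guard (isReducedLatin L) (weight n (oddRows L) ℤ.* weight n (oddCols L))) arrays ∎
    where
    open ≡.≡-Reasoning
    open HalfRange n odd using (∑-types)
    H = halfRange n
    rowType colType : Array n → ℕ → ℤ
    rowType L k = guard (typeMatches n (oddRows L) k) (weight n k)
    colType L l = guard (typeMatches n (oddCols L) l) (weight n l)
    G : ℕ → ℕ → Array n → ℤ
    G k l L = guard (isReducedLatin L) (rowType L k ℤ.* colType L l)

  Cell : Set
  Cell = Array n × (Fin n × Fin n)

  ArrayEq : BoolEq (Array n)
  ArrayEq = FunEq (FunEq (FinEq n) n) n

  CellEq : BoolEq Cell
  CellEq = PairEq ArrayEq (PairEq (FinEq n) (FinEq n))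

  cells : List Cell
  cells = pairs arrays (pairs AF AF)

  cells-enumerate : Enumerates CellEq cells
  cells-enumerate = pairs-enumerates ArrayEq (PairEq (FinEq n) (FinEq n)) arrays (pairs AF AF) arrays-enumerate
                      (pairs-enumerates (FinEq n) (FinEq n) AF AF (allFin-enumerates n) (allFin-enumerates n))
    where
    arrays-enumerate : Enumerates ArrayEq arrays
    arrays-enumerate = allFuns-enumerates (FunEq (FinEq n) n) (allFuns AF n)
                         (allFuns-enumerates (FinEq n) AF (allFin-enumerates n) n) n

  ArrayEq⇒≋ : ∀ {L L′} → BoolEq.eq ArrayEq L L′ ≡ true → L ≋ L′
  ArrayEq⇒≋ {L} {L′} h i j = ==⇒≡ _ _ (allF²⇒ n (λ i j → L i j == L′ i j) h i j)

  ≋⇒ArrayEq : ∀ {L L′} → L ≋ L′ → BoolEq.eq ArrayEq L L′ ≡ true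
  ≋⇒ArrayEq {L} {L′} L≋L′ = allF²⇐ n (λ i j → L i j == L′ i j) (λ i j → ≡⇒== (L≋L′ i j))

  Ψ : Cell → Cell
  Ψ (L , r , c) = Isotopy.square L r c , Isotopy.row′ L r c , c

  reduced : Cell → Bool
  reduced (L , _) = isReducedLatin L

  cellSign : Cell → ℤ
  cellSign (L , _) = sign (isOddSquare L)

  reduced-resp : Respects CellEq reduced
  reduced-resp (L , _) (L′ , _) h = isReducedLatin-cong {L = L} {L′} (ArrayEq⇒≋ {L} {L′} (∧-proj₁ h))

  cellSign-resp : Respects CellEq cellSign
  cellSign-resp (L , _) (L′ , _) h = cong sign (isOddSquare-cong {L = L} {L′} (ArrayEq⇒≋ {L} {L′} (∧-proj₁ h)))

  Ψ-preserves : PreservesEq CellEq Ψ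
  Ψ-preserves (L , r , c) (L′ , r′ , c′) h
    with ==⇒≡ r r′ (∧-proj₁ (∧-proj₂ {BoolEq.eq ArrayEq L L′} h))
       | ==⇒≡ c c′ (∧-proj₂ {r == r′} (∧-proj₂ {BoolEq.eq ArrayEq L L′} h))
  ... | refl | refl = ∧-intro (≋⇒ArrayEq (proj₁ same)) (∧-intro (≡⇒== (proj₂ same)) (==-refl c))
    where
    same = isotopy-cong r c (ArrayEq⇒≋ {L} {L′} (∧-proj₁ h))

  Ψ-reduced : ∀ x → reduced x ≡ true → reduced (Ψ x) ≡ true
  Ψ-reduced (L , r , c) h = ⇒isReducedLatin _ (IsotopyProperties.reducedLatin L r c (isReducedLatin⇒ L h))

  Ψ-involutive : ∀ x → reduced x ≡ true → BoolEq.eq CellEq (Ψ (Ψ x)) x ≡ true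
  Ψ-involutive (L , r , c) h = ∧-intro (≋⇒ArrayEq (P.involutive-square)) (∧-intro (≡⇒== P.involutive-row) (==-refl c))
    where module P = IsotopyProperties L r c (isReducedLatin⇒ L h)

  Ψ-sign : ∀ x → reduced x ≡ true →
           cellSign (Ψ x) ≡ cellSign x ℤ.* (sign (lineOdd (λ j → proj₁ x (proj₁ (proj₂ x)) j)) ℤ.*
                                             sign (lineOdd (λ i → proj₁ x i (proj₂ (proj₂ x)))))
  Ψ-sign (L , r , c) h = begin
    sign (isOddSquare (Isotopy.square L r c))
      ≡⟨ cong sign (IsotopyProperties.isOddSquare-square L r c (isReducedLatin⇒ L h) odd) ⟩
    sign (isOddSquare L xor (lineOdd (λ j → L r j) xor lineOdd (λ i → L i c)))
      ≡⟨ sign-xor (isOddSquare L) _ ⟩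
    sign (isOddSquare L) ℤ.* sign (lineOdd (λ j → L r j) xor lineOdd (λ i → L i c))
      ≡⟨ cong (sign (isOddSquare L) ℤ.*_) (sign-xor (lineOdd (λ j → L r j)) (lineOdd (λ i → L i c))) ⟩
    sign (isOddSquare L) ℤ.* (sign (lineOdd (λ j → L r j)) ℤ.* sign (lineOdd (λ i → L i c))) ∎
    where open ≡.≡-Reasoning

  -- The isotopy is an involution on the cells of reduced Latin squares, so it
  -- permutes the summands of a sum over such cells.
  isotopy-reindex : ∑ℤ (λ x → guard (reduced x) (cellSign (Ψ x))) cells ≡ ∑ℤ (λ x → guard (reduced x) (cellSign x)) cells
  isotopy-reindex = ℤ∑.Enumerated.reindex CellEq cells cells-enumerate Ψ Ψ Ψ-preserves Ψ-preserves
    reduced reduced-resp cellSign cellSign-resp Ψ-reduced Ψ-reduced Ψ-involutive Ψ-involutive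

  ∑-cells : (f : Cell → ℤ) → ∑ℤ f cells ≡ ∑ℤ (λ L → ∑ℤ (λ r → ∑ℤ (λ c → f (L , r , c)) AF) AF) arrays
  ∑-cells f = ≡.trans (ℤ∑.∑-pairs f arrays (pairs AF AF)) (ℤ∑.∑-cong arrays (λ L → ℤ∑.∑-pairs (λ rc → f (L , rc)) AF AF))

  ∑-image-signs : ∑ℤ (λ x → guard (reduced x) (cellSign (Ψ x))) cells
                ≡ ∑ℤ (λ L → guard (isReducedLatin L) (weight n (oddRows L) ℤ.* weight n (oddCols L))) arrays
  ∑-image-signs = begin
    ∑ℤ (λ x → guard (reduced x) (cellSign (Ψ x))) cells
      ≡⟨ ℤ∑.∑-cong cells (λ x → ℤ∑.guard-cong (reduced x) (Ψ-sign x)) ⟩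
    ∑ℤ (λ x → guard (reduced x) (cellSign x ℤ.* (rowSign x ℤ.* colSign x))) cells
      ≡⟨ ∑-cells (λ x → guard (reduced x) (cellSign x ℤ.* (rowSign x ℤ.* colSign x))) ⟩
    ∑ℤ (λ L → ∑ℤ (λ r → ∑ℤ (λ c → guard (isReducedLatin L) (s L ℤ.* (R L r ℤ.* C L c))) AF) AF) arrays
      ≡⟨ ℤ∑.∑-cong arrays (λ L → ≡.trans (guard-∑∑ (isReducedLatin L) (λ r c → s L ℤ.* (R L r ℤ.* C L c)) AF AF)
                                         (cong (guard (isReducedLatin L)) (factor L))) ⟩
    ∑ℤ (λ L → guard (isReducedLatin L) (s L ℤ.* (rowSignSum L ℤ.* colSignSum L))) arrays
      ≡⟨ ℤ∑.∑-cong arrays (λ L → cong (guard (isReducedLatin L)) (signed-line-sums L)) ⟩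
    ∑ℤ (λ L → guard (isReducedLatin L) (weight n (oddRows L) ℤ.* weight n (oddCols L))) arrays ∎
    where
    open ≡.≡-Reasoning
    rowSign colSign : Cell → ℤ
    rowSign (L , r , _) = sign (lineOdd (λ j → L r j))
    colSign (L , _ , c) = sign (lineOdd (λ i → L i c))
    s : Array n → ℤ
    s L = sign (isOddSquare L)
    R C : Array n → Fin n → ℤ
    R L r = sign (lineOdd (λ j → L r j))
    C L c = sign (lineOdd (λ i → L i c))
    factor : ∀ L → ∑ℤ (λ r → ∑ℤ (λ c → s L ℤ.* (R L r ℤ.* C L c)) AF) AF ≡ s L ℤ.* (rowSignSum L ℤ.* colSignSum L)
    factor L = ≡.sym (begin
      s L ℤ.* (∑ℤ (R L) AF ℤ.* ∑ℤ (C L) AF)                   ≡⟨ cong (s L ℤ.*_) (ℤ∑.∑-product (R L) (C L) AF AF) ⟨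
      s L ℤ.* ∑ℤ (λ r → ∑ℤ (λ c → R L r ℤ.* C L c) AF) AF      ≡⟨ ℤ∑.∑-*ˡ (s L) _ AF ⟩
      ∑ℤ (λ r → s L ℤ.* ∑ℤ (λ c → R L r ℤ.* C L c) AF) AF      ≡⟨ ℤ∑.∑-cong AF (λ r → ℤ∑.∑-*ˡ (s L) _ AF) ⟩
      ∑ℤ (λ r → ∑ℤ (λ c → s L ℤ.* (R L r ℤ.* C L c)) AF) AF    ∎)

  signedCount : ℤ
  signedCount = ∑ℤ (λ L → guard (isReducedLatin L) (sign (isOddSquare L))) arrays

  signedCount≡ : signedCount ≡ + RELS-card n ℤ.- + ROLS-card n
  signedCount≡ = begin
    signedCount
      ≡⟨ ℤ∑.∑-cong arrays (λ L → split (isReducedLatin L) (isOddSquare L)) ⟩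
    ∑ℤ (λ L → even L ℤ.+ guard (isReducedLatin L ∧ isOddSquare L) -1ℤ) arrays
      ≡⟨ ℤ∑.∑-+ even (λ L → guard (isReducedLatin L ∧ isOddSquare L) -1ℤ) arrays ⟩
    ∑ℤ even arrays ℤ.+ ∑ℤ (λ L → guard (isReducedLatin L ∧ isOddSquare L) -1ℤ) arrays
      ≡⟨ cong₂ ℤ._+_ (≡.sym (+count≡∑ _ arrays)) (ℤ∑.∑-guard _ -1ℤ arrays) ⟩
    + RELS-card n ℤ.+ ℤ∑.fromℕ (ROLS-card n) ℤ.* -1ℤ
      ≡⟨ cong (λ z → + RELS-card n ℤ.+ z) (≡.trans (cong (ℤ._* -1ℤ) (fromℕ≡+ (ROLS-card n))) (ℤP.*-comm (+ ROLS-card n) -1ℤ)) ⟩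
    + RELS-card n ℤ.+ -1ℤ ℤ.* + ROLS-card n
      ≡⟨ cong (λ z → + RELS-card n ℤ.+ z) (ℤP.-1*i≡-i (+ ROLS-card n)) ⟩
    + RELS-card n ℤ.- + ROLS-card n ∎
    where
    open ≡.≡-Reasoning
    even : Array n → ℤ
    even L = guard (isReducedLatin L ∧ not (isOddSquare L)) 1ℤ
    split : ∀ b o → guard b (sign o) ≡ guard (b ∧ not o) 1ℤ ℤ.+ guard (b ∧ o) -1ℤ
    split false o     = refl
    split true  true  = refl
    split true  false = refl

  -- Each reduced Latin square contributes its sign once for each of its n² cells.
  ∑-signs : ∑ℤ (λ x → guard (reduced x) (cellSign x)) cells ≡ (+ n ℤ.* + n) ℤ.* signedCount
  ∑-signs = begin
    ∑ℤ (λ x → guard (reduced x) (cellSign x)) cells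
      ≡⟨ ∑-cells (λ x → guard (reduced x) (cellSign x)) ⟩
    ∑ℤ (λ L → ∑ℤ (λ _ → ∑ℤ (λ _ → g L) AF) AF) arrays
      ≡⟨ ℤ∑.∑-cong arrays (λ L → ≡.trans (ℤ∑.∑-cong AF (λ _ → n-copies (g L))) (n-copies (+ n ℤ.* g L))) ⟩
    ∑ℤ (λ L → + n ℤ.* (+ n ℤ.* g L)) arrays
      ≡⟨ ℤ∑.∑-cong arrays (λ L → ≡.sym (ℤP.*-assoc (+ n) (+ n) (g L))) ⟩
    ∑ℤ (λ L → (+ n ℤ.* + n) ℤ.* g L) arrays
      ≡⟨ ℤ∑.∑-*ˡ (+ n ℤ.* + n) g arrays ⟨
    (+ n ℤ.* + n) ℤ.* signedCount ∎
    where
    open ≡.≡-Reasoning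
    g : Array n → ℤ
    g L = guard (isReducedLatin L) (sign (isOddSquare L))
    n-copies : ∀ v → ∑ℤ (λ _ → v) AF ≡ + n ℤ.* v
    n-copies v = ≡.trans (ℤ∑.∑-const n v) (cong (ℤ._* v) (fromℕ≡+ n))

  paritySum≡ : paritySum n ≡ (+ n ℤ.* + n) ℤ.* (+ RELS-card n ℤ.- + ROLS-card n)
  paritySum≡ = begin
    paritySum n                                                          ≡⟨ paritySum≡∑weights ⟩
    ∑ℤ (λ L → guard (isReducedLatin L) (weight n (oddRows L) ℤ.* weight n (oddCols L))) arrays
                                                                         ≡⟨ ∑-image-signs ⟨
    ∑ℤ (λ x → guard (reduced x) (cellSign (Ψ x))) cells                  ≡⟨ isotopy-reindex ⟩
    ∑ℤ (λ x → guard (reduced x) (cellSign x)) cells                      ≡⟨ ∑-signs ⟩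
    (+ n ℤ.* + n) ℤ.* signedCount                                        ≡⟨ cong ((+ n ℤ.* + n) ℤ.*_) signedCount≡ ⟩
    (+ n ℤ.* + n) ℤ.* (+ RELS-card n ℤ.- + ROLS-card n)                  ∎
    where open ≡.≡-Reasoning

proposition3p3 : (n : ℕ) → Odd n →
    (RELS-card n ≢ ROLS-card n) ⇔ (paritySum n ≢ 0ℤ)
proposition3p3 zero    ()
proposition3p3 (suc m) odd = mk⇔ forth back
  where
  R = RELS-card (suc m)
  O = ROLS-card (suc m)
  n² = + suc m ℤ.* + suc m

  identity : paritySum (suc m) ≡ n² ℤ.* (+ R ℤ.- + O)
  identity = MainIdentity.paritySum≡ m (cong (_≡ᵇ 1) odd)

  forth : R ≢ O → paritySum (suc m) ≢ 0ℤ
  forth R≢O sum≡0 = Data.Sum.[ n²≢0 , (λ R-O≡0 → R≢O (ℤP.+-injective (ℤP.i-j≡0⇒i≡j (+ R) (+ O) R-O≡0))) ]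
                      (ℤP.i*j≡0⇒i≡0∨j≡0 n² {+ R ℤ.- + O} (≡.trans (≡.sym identity) sum≡0))
    where
    n²≢0 : n² ≢ 0ℤ
    n²≢0 ()

  back : paritySum (suc m) ≢ 0ℤ → R ≢ O
  back sum≢0 R≡O = sum≢0 (begin
    paritySum (suc m)         ≡⟨ identity ⟩
    n² ℤ.* (+ R ℤ.- + O)      ≡⟨ cong (λ k → n² ℤ.* (+ k ℤ.- + O)) R≡O ⟩
    n² ℤ.* (+ O ℤ.- + O)      ≡⟨ cong (n² ℤ.*_) (ℤP.+-inverseʳ (+ O)) ⟩
    n² ℤ.* 0ℤ                 ≡⟨ ℤP.*-zeroʳ n² ⟩
    0ℤ                        ∎)
    where open ≡.≡-Reasoning
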